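{- Let $F=\mathbb{F}_q$, $q=2^r$, and let $(F,+,\circ)$ be a symplectic presemifield with multiplication written uniquely as $x\circ y=\sum_{i,j=0}^{r-1}a_{ij}x^{2^i}y^{2^j}$. Then the bases $$B_\infty=\{e_w\mid w\in F\},\qquad B_m=\{b_{m,v}\mid v\in F\}\ (m\in F),\qquad b_{m,v}=\frac{1}{\sqrt q}\sum_{w\in F}\omega^{{\rm Tr}(\hat w\cdot(\hat w\circ\hat m)+2\hat w\hat v)}e_w,$$ form a complete set of mutually unbiased bases of $\mathbb{C}^q$.
   Context: $\omega\in\mathbb{C}$ is a primitive $4$th root of unity (so $\omega^a$, $a\in\mathbb{Z}_4$, is well defined), and $\{e_w\}_{w\in F}$ is the standard basis of $\mathbb{C}^q$. ${\rm tr}:\mathbb{F}_q\to\mathbb{F}_2$ is the absolute trace. A presemifield $(F,+,\circ)$ is the additive group of $F$ with a multiplication $\circ$, left and right distributive over $+$, with no zero divisors; it is symplectic if each subspace $\{(0,y)\mid y\in F\}$ and $\{(x,x\circ y)\mid x\in F\}$ ($y\in F$) of $F\oplus F$ is totally isotropic for the form $\langle(u,v),(u',v')\rangle={\rm tr}(uv'-vu')$. $R=GR(4^r)$ is the Galois ring of characteristic $4$ and order $4^r$ ($R/2R\cong\mathbb{F}_q$), $\mathcal{T}=\{0\}\cup C$ its Teichmüller set ($C$ the cyclic subgroup of order $2^r-1$ of $R^*$), $\hat u\in\mathcal{T}$ the Teichmüller lift of $u\in F$. For $x=a+2b$ ($a,b\in\mathcal{T}$), ${\rm Tr}(x)=\sum_{i=0}^{r-1}(a^{2^i}+2b^{2^i})\in\mathbb{Z}_4$.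 The extension of $\circ$ is $\hat x\circ\hat y=\sum_{i,j}\widehat{a_{ij}}\hat x^{2^i}\hat y^{2^j}$. A complete set of MUBs of $\mathbb{C}^q$ is a set of $q+1$ orthonormal bases with $|(x,y)|^2=1/q$ for $x,y$ in distinct bases. -}

module Defs where

open import Data.Nat as ℕ using (ℕ; zero; suc; _^_; _∸_; _<_)
open import Data.Fin using (Fin; toℕ)
open import Data.List using (List; foldr; length; map; allFin)
open import Data.List.Relation.Unary.Unique.Propositional using (Unique)
open import Data.List.Membership.Propositional using (_∈_)
open import Data.Integer as ℤ using (ℤ; +_)
open import Data.Product using (Σ; ∃; _×_; _,_)
open import Data.Sum using (_⊎_)
open import Data.Maybe using (Maybe; just; nothing)
open import Relation.Binary.PropositionalEquality using (_≡_)
open import Relation.Binary.Definitions using (DecidableEquality)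
open import Relation.Nullary using (¬_; yes; no)
open import Algebra.Structures using (IsCommutativeRing)
open import Function.Bundles using (_⇔_)

-- Finite commutative rings (equality is propositional equality).
-- Decidable equality is included as a field; it is in fact derivable
-- from the complete, duplicate-free enumeration.

record FinCommRing : Set₁ where
  infixl 6 _+_
  infixl 7 _*_
  field
    Carrier : Set
    _+_ _*_ : Carrier → Carrier → Carrier
    -_ : Carrier → Carrier
    0# 1# : Carrier
    isCommutativeRing : IsCommutativeRing _≡_ _+_ _*_ -_ 0# 1#
    elems : List Carrier
    elems-unique : Unique elems
    elems-complete : ∀ x → x ∈ elems
    _≟_ : DecidableEquality Carrier

  _-_ : Carrier → Carrier → Carrier
  x - y = x + (- y)

  pow : Carrier → ℕ → Carrier
  pow x zero = 1#
  pow x (suc n) = x * pow x n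

  ι : ℕ → Carrier
  ι zero = 0#
  ι (suc n) = 1# + ι n

  two : Carrier
  two = 1# + 1#

  sumFin : (n : ℕ) → (Fin n → Carrier) → Carrier
  sumFin n f = foldr _+_ 0# (map f (allFin n))

Car : FinCommRing → Set
Car = FinCommRing.Carrier

record IsFieldOfOrder (F : FinCommRing) (q : ℕ) : Set where
  open FinCommRing F
  field
    card : length elems ≡ q
    0≢1 : ¬ (0# ≡ 1#)
    inverse : ∀ x → ¬ (x ≡ 0#) → ∃ λ y → x * y ≡ 1#

absTr : (F : FinCommRing) (r : ℕ) → Car F → Car F
absTr F r x = sumFin r (λ i → pow x (2 ^ toℕ i))
  where open FinCommRing F

-- R = GR(4^r): a finite commutative ring of characteristic 4, of order
-- 4^r, together with a surjective ring homomorphism π : R → F with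
-- kernel 2R (so R/2R ≅ F = 𝔽_q).  These properties characterise GR(4^r).

record IsGaloisRing4 (r : ℕ) (F R : FinCommRing)
                     (π : Car R → Car F) : Set where
  private
    module F = FinCommRing F
    module R = FinCommRing R
  field
    card : length R.elems ≡ 4 ^ r
    char4 : R.ι 4 ≡ R.0#
    char≢2 : ¬ (R.ι 2 ≡ R.0#)
    π-+ : ∀ x y → π (x R.+ y) ≡ π x F.+ π y
    π-* : ∀ x y → π (x R.* y) ≡ π x F.* π y
    π-1 : π R.1# ≡ F.1#
    π-surjective : ∀ u → ∃ λ x → π x ≡ u
    π-kernel : ∀ x → (π x ≡ F.0#) ⇔ (∃ λ y → x ≡ R.two R.* y)

-- C, the cyclic subgroup of order 2^r - 1 of R*, given by a generator g
-- of multiplicative order exactly 2^r - 1.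
record CyclicGen (r : ℕ) (R : FinCommRing) : Set where
  open FinCommRing R
  field
    g : Carrier
    g-order : pow g (2 ^ r ∸ 1) ≡ 1#
    g-primitive : ∀ k → 0 < k → k < 2 ^ r ∸ 1 → ¬ (pow g k ≡ 1#)

InTeich : {r : ℕ} (R : FinCommRing) → CyclicGen r R → Car R → Set
InTeich R C x = x ≡ 0# ⊎ ∃ λ k → x ≡ pow (CyclicGen.g C) k
  where open FinCommRing R

IsTeichLift : {r : ℕ} (F R : FinCommRing) (π : Car R → Car F)
              (C : CyclicGen r R) (hat : Car F → Car R) → Set
IsTeichLift F R π C hat = ∀ u → InTeich R C (hat u) × π (hat u) ≡ u

IsGRTrace : (r : ℕ) (R : FinCommRing) (C : CyclicGen r R)
            (Tr : Car R → Fin 4) → Set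
IsGRTrace r R C Tr =
  ∀ a b → InTeich R C a → InTeich R C b →
    ι (toℕ (Tr (a + two * b)))
      ≡ sumFin r (λ i → pow a (2 ^ toℕ i) + two * pow b (2 ^ toℕ i))
  where open FinCommRing R

record IsSymplecticPresemifield (r : ℕ) (F : FinCommRing)
          (_∘_ : Car F → Car F → Car F) : Set where
  open FinCommRing F
  field
    distribˡ : ∀ x y z → x ∘ (y + z) ≡ (x ∘ y) + (x ∘ z)
    distribʳ : ∀ x y z → (y + z) ∘ x ≡ (y ∘ x) + (z ∘ x)
    no-zero-divisors : ∀ x y → x ∘ y ≡ 0# → x ≡ 0# ⊎ y ≡ 0#
    -- {(0,y) | y ∈ F} is totally isotropic
    isotropic-vertical : ∀ y y' → absTr F r ((0# * y') - (y * 0#)) ≡ 0#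
    -- for each y, {(x, x ∘ y) | x ∈ F} is totally isotropic
    isotropic-graph : ∀ y x x' →
      absTr F r ((x * (x' ∘ y)) - ((x ∘ y) * x')) ≡ 0#

linearized : (K : FinCommRing) (r : ℕ) (a : Fin r → Fin r → Car K)
             → Car K → Car K → Car K
linearized K r a x y =
  sumFin r (λ i → sumFin r (λ j → a i j * pow x (2 ^ toℕ i) * pow y (2 ^ toℕ j)))
  where open FinCommRing K

-- Gaussian integers ℤ[i] ⊆ ℂ (all vector entries, up to the scalar
-- 1/√q, lie in ℤ[i]).

infix 5 _+i_

record ℤi : Set where
  constructor _+i_
  field
    re im : ℤ

infixl 6 _+ᵢ_
infixl 7 _*ᵢ_

_+ᵢ_ : ℤi → ℤi → ℤi
(a +i b) +ᵢ (c +i d) = (a ℤ.+ c) +i (b ℤ.+ d)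

_*ᵢ_ : ℤi → ℤi → ℤi
(a +i b) *ᵢ (c +i d) = (a ℤ.* c ℤ.- b ℤ.* d) +i (a ℤ.* d ℤ.+ b ℤ.* c)

conjᵢ : ℤi → ℤi
conjᵢ (a +i b) = a +i (ℤ.- b)

normSq : ℤi → ℤ
normSq (a +i b) = a ℤ.* a ℤ.+ b ℤ.* b

0ᵢ 1ᵢ -1ᵢ : ℤi
0ᵢ = + 0 +i + 0
1ᵢ = + 1 +i + 0
-1ᵢ = ℤ.- (+ 1) +i + 0

fromℕᵢ : ℕ → ℤi
fromℕᵢ n = (+ n) +i (+ 0)

powᵢ : ℤi → ℕ → ℤi
powᵢ z zero = 1ᵢ
powᵢ z (suc n) = z *ᵢ powᵢ z n

-- Vectors of ℂ^q are indexed by F (coordinates w.r.t. {e_w}).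
-- A family of vectors is given as  (1/s) · X  with X : F → ℤ[i]
-- and s > 0 real; only s² ∈ ℕ is recorded.

innerᵢ : (F : FinCommRing) → (Car F → ℤi) → (Car F → ℤi) → ℤi
innerᵢ F X Y = foldr _+ᵢ_ 0ᵢ (map (λ w → X w *ᵢ conjᵢ (Y w)) (FinCommRing.elems F))

-- The family of vectors b_{s,v} = vec s v / √(scaleSq s)
-- (s ∈ Maybe F, nothing = ∞, v ∈ F) is a complete set of q+1 MUBs of ℂ^q
-- (q = |F|): each B_s = {b_{s,v}}_v is an orthonormal basis (q orthonormal
-- vectors in ℂ^q) and |(x,y)|² = 1/q for x, y in distinct bases.
record IsCompleteMUB (F : FinCommRing) (q : ℕ)
         (vec : Maybe (Car F) → Car F → Car F → ℤi)
         (scaleSq : Maybe (Car F) → ℕ) : Set where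
  field
    dimension : length (FinCommRing.elems F) ≡ q
    orthogonal : ∀ s v v' → ¬ (v ≡ v') → innerᵢ F (vec s v) (vec s v') ≡ 0ᵢ
    normalized : ∀ s v → innerᵢ F (vec s v) (vec s v) ≡ fromℕᵢ (scaleSq s)
    unbiased : ∀ s s' → ¬ (s ≡ s') → ∀ v v' →
      (+ q) ℤ.* normSq (innerᵢ F (vec s v) (vec s' v'))
        ≡ + (scaleSq s ℕ.* scaleSq s')

module _ (r : ℕ) (F R : FinCommRing)
         (hat : Car F → Car R) (Tr : Car R → Fin 4)
         (ω : ℤi) (a : Fin r → Fin r → Car F) where
  private
    module F = FinCommRing F
    module R = FinCommRing R

  circR : Car R → Car R → Car R
  circR = linearized R r (λ i j → hat (a i j))

  mubVec : Maybe (Car F) → Car F → Car F → ℤi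
  mubVec nothing v w with w F.≟ v
  ... | yes _ = 1ᵢ
  ... | no _ = 0ᵢ
  mubVec (just m) v w =
    powᵢ ω (toℕ (Tr ((hat w R.* circR (hat w) (hat m)) R.+ (R.two R.* hat w R.* hat v))))

  mubScaleSq : Maybe (Car F) → ℕ
  mubScaleSq nothing = 1
  mubScaleSq (just _) = 2 ^ r

-- For m ∈ F the entries of √q b_{m,v} are ω^(Q_m(w) + 2 tr(w v)), where Q_m(w) = Tr(ŵ (ŵ ∘ m̂)) ∈ ℤ₄.
-- Writing x ∘ y = Σ a_ij x^(2^i) y^(2^j), symplecticity says that tr(w (u ∘ m)) is symmetric in w and u;
-- by Artin's independence of the Frobenius powers this forces a_ij = a_{r-i,j-i}^(2^i) (indices mod r).
-- The identity survives Teichmüller lifting, so Tr(x̂ (ŷ ∘ m̂)) is symmetric for Teichmüller x̂, ŷ, and Q_m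
-- is a ℤ₄-valued quadratic form: Q_m(w + u) = Q_m(w) + Q_m(u) + 2 tr(w (u ∘ m)).
-- Inner products of basis vectors are then character sums Σ_w ω^(…). Within B_m the exponent difference
-- is 2 tr(w (v + v′)), a nontrivial character, so the sum vanishes. Between B_m and B_m′ the squared
-- modulus expands to Σ_z Σ_u ω^(…), whose inner sum is a nontrivial character sum unless
-- z ∘ (m + m′) = 0, i.e. z = 0; this leaves q. All entries of b_{m,v} have modulus 1/√q, which makes
-- B_∞ unbiased to every B_m.

module Submission where

open import Defs
open import Level using (0ℓ)
open import Algebra.Bundles using (CommutativeRing)
open import Algebra.Core using (Op₁; Op₂)
open import Algebra.Structures using (IsCommutativeRing)
import Algebra.Properties.CommutativeSemigroup as CommutativeSemigroupProperties
import Algebra.Properties.CommutativeSemiring.Exp as CommutativeSemiringExp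
import Algebra.Properties.Ring as RingProperties
import Algebra.Properties.Semiring.Mult as SemiringMult
import Algebra.Solver.Ring
import Algebra.Solver.Ring.AlmostCommutativeRing as AlmostCommutativeRing
open import Data.Empty using (⊥-elim)
open import Data.Fin as Fin using (Fin; toℕ)
import Data.Fin.Properties as Fin
open import Data.Integer as ℤ using (ℤ; +0; +[1+_]; -[1+_])
import Data.Integer.Properties as ℤP
open import Data.Integer.Tactic.RingSolver using (solve-∀)
open import Data.List using (List; []; _∷_; allFin; foldr; length; map; tabulate)
import Data.List.Properties as List
open import Data.List.Membership.Propositional using (_∈_)
open import Data.List.Relation.Unary.All as All using (All; []; _∷_; all?)
open import Data.List.Relation.Unary.All.Properties using (¬All⇒Any¬)
open import Data.List.Relation.Unary.AllPairs using (_∷_)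
open import Data.List.Relation.Unary.Any as Any using (here; there)
open import Data.List.Relation.Unary.Unique.Propositional using (Unique)
open import Data.Maybe using (Maybe; just; nothing)
open import Data.Nat as ℕ using (ℕ; zero; suc; _^_; _∸_)
import Data.Nat.DivMod as DM
import Data.Nat.Properties as ℕ
open import Data.Product using (∃; _,_; proj₁; proj₂)
open import Data.Sign as Sign using (Sign)
open import Data.Sum using (inj₁; inj₂; [_,_]′)
open import Function using (id)
open import Function.Bundles using (Equivalence)
open import Relation.Binary.Definitions using (DecidableEquality)
open import Relation.Binary.PropositionalEquality
open import Relation.Nullary using (¬_; yes; no)

private
  module ℕ+ = CommutativeSemigroupProperties ℕ.+-commutativeSemigroup

module CommutativeRingProperties
  {A : Set} {add mul : Op₂ A} {neg : Op₁ A} {0ᴬ 1ᴬ : A}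
  (isCommutativeRing : IsCommutativeRing _≡_ add mul neg 0ᴬ 1ᴬ) where

  commutativeRing : CommutativeRing 0ℓ 0ℓ
  commutativeRing = record { isCommutativeRing = isCommutativeRing }

  open CommutativeRing commutativeRing public
    using ( _+_; _*_; -_; 0#; 1#; +-assoc; +-comm; +-identityˡ; +-identityʳ; -‿inverseˡ; -‿inverseʳ
          ; *-assoc; *-comm; *-identityˡ; *-identityʳ; distribˡ; distribʳ; zeroˡ; zeroʳ)
  open CommutativeRing commutativeRing using (ring; semiring; commutativeSemiring)
  open RingProperties ring public
    using (-0#≈0#; -‿involutive; -‿+-comm; +-inverseʳ-unique; -‿distribˡ-*; x∙y⁻¹≈ε⇒x≈y; x+x≈x⇒x≈0; +-cancelˡ)
  open SemiringMult semiring public using (_×_; ×-homo-+; ×1-homo-*)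
  open CommutativeSemiringExp commutativeSemiring public
    using (^-homo-*; ^-assocʳ; ^-distrib-*) renaming (_^_ to _^ᴿ_)
  open ≡-Reasoning

  -- The canonical map ℤ → A is a ring homomorphism, so the solver can use ℤ-coefficients.

  private
    signed : Sign → A → A
    signed Sign.+ x = x
    signed Sign.- x = - x

    signed-* : ∀ s t x y → signed (s Sign.* t) (x * y) ≡ signed s x * signed t y
    signed-* Sign.+ Sign.+ x y = refl
    signed-* Sign.+ Sign.- x y = RingProperties.-‿distribʳ-* ring x y
    signed-* Sign.- Sign.+ x y = -‿distribˡ-* x y
    signed-* Sign.- Sign.- x y = begin
      x * y             ≡⟨ sym (-‿involutive (x * y)) ⟩
      - (- (x * y))     ≡⟨ cong -_ (-‿distribˡ-* x y) ⟩
      - (- x * y)       ≡⟨ RingProperties.-‿distribʳ-* ring (- x) y ⟩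
      - x * - y         ∎

  fromℤ : ℤ → A
  fromℤ (ℤ.+ n) = n × 1#
  fromℤ -[1+ n ] = - (suc n × 1#)

  private
    fromℤ-signed : ∀ s n → fromℤ (s ℤ.◃ n) ≡ signed s (n × 1#)
    fromℤ-signed s zero = sym (signed-0 s)
      where signed-0 : ∀ s → signed s 0# ≡ 0#
            signed-0 Sign.+ = refl
            signed-0 Sign.- = -0#≈0#
    fromℤ-signed Sign.+ (suc n) = refl
    fromℤ-signed Sign.- (suc n) = refl

    fromℤ-sign-abs : ∀ i → fromℤ i ≡ signed (ℤ.sign i) (ℤ.∣ i ∣ × 1#)
    fromℤ-sign-abs i = trans (cong fromℤ (sym (ℤP.◃-inverse i))) (fromℤ-signed (ℤ.sign i) ℤ.∣ i ∣)

    fromℤ-⊖ : ∀ m n → fromℤ (m ℤ.⊖ n) ≡ m × 1# + - (n × 1#)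
    fromℤ-⊖ zero zero = sym (trans (+-identityˡ _) -0#≈0#)
    fromℤ-⊖ zero (suc n) = sym (+-identityˡ _)
    fromℤ-⊖ (suc m) zero = sym (trans (cong (λ z → suc m × 1# + z) -0#≈0#) (+-identityʳ _))
    fromℤ-⊖ (suc m) (suc n) = begin
      fromℤ (suc m ℤ.⊖ suc n)          ≡⟨ cong fromℤ (ℤP.[1+m]⊖[1+n]≡m⊖n m n) ⟩
      fromℤ (m ℤ.⊖ n)                  ≡⟨ fromℤ-⊖ m n ⟩
      a + - b                          ≡⟨ cong (a +_) (sym (+-identityˡ (- b))) ⟩
      a + (0# + - b)                   ≡⟨ cong (λ z → a + (z + - b)) (sym (-‿inverseʳ 1#)) ⟩
      a + ((1# + - 1#) + - b)          ≡⟨ cong (a +_) (+-assoc 1# (- 1#) (- b)) ⟩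
      a + (1# + (- 1# + - b))          ≡⟨ sym (+-assoc a 1# _) ⟩
      (a + 1#) + (- 1# + - b)          ≡⟨ cong₂ _+_ (+-comm a 1#) (-‿+-comm 1# b) ⟩
      (1# + a) + - (1# + b)            ∎
      where
      a b : A
      a = m × 1#
      b = n × 1#

  fromℤ-+ : ∀ i j → fromℤ (i ℤ.+ j) ≡ fromℤ i + fromℤ j
  fromℤ-+ (ℤ.+ m) (ℤ.+ n) = ×-homo-+ 1# m n
  fromℤ-+ (ℤ.+ m) -[1+ n ] = fromℤ-⊖ m (suc n)
  fromℤ-+ -[1+ m ] (ℤ.+ n) = trans (fromℤ-⊖ n (suc m)) (+-comm _ _)
  fromℤ-+ -[1+ m ] -[1+ n ] = begin
    - (suc (suc (m ℕ.+ n)) × 1#)          ≡⟨ cong (λ k → - (suc k × 1#)) (sym (ℕ.+-suc m n)) ⟩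
    - ((suc m ℕ.+ suc n) × 1#)            ≡⟨ cong -_ (×-homo-+ 1# (suc m) (suc n)) ⟩
    - (suc m × 1# + suc n × 1#)           ≡⟨ sym (-‿+-comm _ _) ⟩
    - (suc m × 1#) + - (suc n × 1#)       ∎

  fromℤ-* : ∀ i j → fromℤ (i ℤ.* j) ≡ fromℤ i * fromℤ j
  fromℤ-* i j = begin
    fromℤ (i ℤ.* j)                                             ≡⟨ fromℤ-signed (ℤ.sign i Sign.* ℤ.sign j) (ℤ.∣ i ∣ ℕ.* ℤ.∣ j ∣) ⟩
    signed (ℤ.sign i Sign.* ℤ.sign j) ((ℤ.∣ i ∣ ℕ.* ℤ.∣ j ∣) × 1#) ≡⟨ cong (signed (ℤ.sign i Sign.* ℤ.sign j)) (×1-homo-* ℤ.∣ i ∣ ℤ.∣ j ∣) ⟩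
    signed (ℤ.sign i Sign.* ℤ.sign j) (ℤ.∣ i ∣ × 1# * ℤ.∣ j ∣ × 1#) ≡⟨ signed-* (ℤ.sign i) (ℤ.sign j) _ _ ⟩
    signed (ℤ.sign i) (ℤ.∣ i ∣ × 1#) * signed (ℤ.sign j) (ℤ.∣ j ∣ × 1#) ≡⟨ sym (cong₂ _*_ (fromℤ-sign-abs i) (fromℤ-sign-abs j)) ⟩
    fromℤ i * fromℤ j                                           ∎

  fromℤ-neg : ∀ i → fromℤ (ℤ.- i) ≡ - fromℤ i
  fromℤ-neg (ℤ.+ zero) = sym -0#≈0#
  fromℤ-neg (ℤ.+ suc n) = refl
  fromℤ-neg -[1+ n ] = sym (-‿involutive _)

  private
    ℤ-coefficients : AlmostCommutativeRing.AlmostCommutativeRing 0ℓ 0ℓ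
    ℤ-coefficients = AlmostCommutativeRing.fromCommutativeRing commutativeRing

    fromℤ-homomorphism : ℤ.+-*-rawRing AlmostCommutativeRing.-Raw-AlmostCommutative⟶ ℤ-coefficients
    fromℤ-homomorphism = record
      { ⟦_⟧ = fromℤ ; +-homo = fromℤ-+ ; *-homo = fromℤ-* ; -‿homo = fromℤ-neg
      ; 0-homo = refl ; 1-homo = +-identityʳ 1# }

    _≟ᶜ_ : ∀ i j → Maybe (fromℤ i ≡ fromℤ j)
    i ≟ᶜ j with i ℤ.≟ j
    ... | yes i≡j = just (cong fromℤ i≡j)
    ... | no _ = nothing

  open Algebra.Solver.Ring ℤ.+-*-rawRing ℤ-coefficients fromℤ-homomorphism _≟ᶜ_ public
    using (solve; _:=_; _:+_; _:*_; :-_; con)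

  -- Finite sums

  sumOver : {I : Set} → List I → (I → A) → A
  sumOver xs f = foldr _+_ 0# (map f xs)

  private variable I I′ : Set

  sumOver-cong : (xs : List I) {f g : I → A} → (∀ i → f i ≡ g i) → sumOver xs f ≡ sumOver xs g
  sumOver-cong [] f≗g = refl
  sumOver-cong (x ∷ xs) f≗g = cong₂ _+_ (f≗g x) (sumOver-cong xs f≗g)

  sumOver-0 : (xs : List I) → sumOver xs (λ _ → 0#) ≡ 0#
  sumOver-0 [] = refl
  sumOver-0 (x ∷ xs) = trans (cong (0# +_) (sumOver-0 xs)) (+-identityˡ 0#)

  sumOver-+ : (xs : List I) (f g : I → A) → sumOver xs (λ i → f i + g i) ≡ sumOver xs f + sumOver xs g
  sumOver-+ [] f g = sym (+-identityˡ 0#)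
  sumOver-+ (x ∷ xs) f g = trans (cong (f x + g x +_) (sumOver-+ xs f g))
    (solve 4 (λ a b c d → (a :+ b) :+ (c :+ d) := (a :+ c) :+ (b :+ d)) refl (f x) (g x) _ _)

  sumOver-neg : (xs : List I) (f : I → A) → sumOver xs (λ i → - f i) ≡ - sumOver xs f
  sumOver-neg [] f = sym -0#≈0#
  sumOver-neg (x ∷ xs) f = trans (cong (- f x +_) (sumOver-neg xs f)) (-‿+-comm _ _)

  sumOver-*ˡ : (xs : List I) (c : A) (f : I → A) → sumOver xs (λ i → c * f i) ≡ c * sumOver xs f
  sumOver-*ˡ [] c f = sym (zeroʳ c)
  sumOver-*ˡ (x ∷ xs) c f = trans (cong (c * f x +_) (sumOver-*ˡ xs c f)) (sym (distribˡ c (f x) _))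

  sumOver-*ʳ : (xs : List I) (c : A) (f : I → A) → sumOver xs (λ i → f i * c) ≡ sumOver xs f * c
  sumOver-*ʳ xs c f = trans (sumOver-cong xs (λ i → *-comm (f i) c)) (trans (sumOver-*ˡ xs c f) (*-comm c _))

  sumOver-const : (xs : List I) (c : A) → sumOver xs (λ _ → c) ≡ length xs × c
  sumOver-const [] c = refl
  sumOver-const (x ∷ xs) c = cong (c +_) (sumOver-const xs c)

  sumOver-swap : (xs : List I) (ys : List I′) (f : I → I′ → A) →
                 sumOver xs (λ i → sumOver ys (f i)) ≡ sumOver ys (λ j → sumOver xs (λ i → f i j))
  sumOver-swap [] ys f = sym (sumOver-0 ys)
  sumOver-swap (x ∷ xs) ys f = trans (cong (sumOver ys (f x) +_) (sumOver-swap xs ys f))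
    (sym (sumOver-+ ys (f x) (λ j → sumOver xs (λ i → f i j))))

  sumOver-vanishing : (xs : List I) (f : I → A) → All (λ i → f i ≡ 0#) xs → sumOver xs f ≡ 0#
  sumOver-vanishing [] f [] = refl
  sumOver-vanishing (x ∷ xs) f (fx≡0 ∷ rest) =
    trans (cong₂ _+_ fx≡0 (sumOver-vanishing xs f rest)) (+-identityˡ 0#)

  sumOver-single : (xs : List I) (f : I → A) (v : I) → Unique xs → v ∈ xs →
                   (∀ i → ¬ (i ≡ v) → f i ≡ 0#) → sumOver xs f ≡ f v
  sumOver-single (x ∷ xs) f v (x∉xs ∷ _) (here refl) vanish = trans
    (cong (f x +_) (sumOver-vanishing xs f (All.map (λ x≢i → vanish _ (λ i≡x → x≢i (sym i≡x))) x∉xs)))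
    (+-identityʳ _)
  sumOver-single (x ∷ xs) f v (x∉xs ∷ unique) (there v∈xs) vanish = trans
    (cong₂ _+_ (vanish x (All.lookup x∉xs v∈xs)) (sumOver-single xs f v unique v∈xs vanish))
    (+-identityˡ _)

  -- Insert the Kronecker delta [j = σ i] and exchange the order of summation.
  sumOver-bijection : {I : Set} → DecidableEquality I → (xs : List I) → Unique xs → (∀ i → i ∈ xs) →
                      (σ τ : I → I) → (∀ i → σ (τ i) ≡ i) → (∀ i → τ (σ i) ≡ i) →
                      (f : I → A) → sumOver xs (λ i → f (σ i)) ≡ sumOver xs f
  sumOver-bijection {I} _≟_ xs unique complete σ τ στ τσ f = begin
    sumOver xs (λ i → f (σ i))                    ≡⟨ sumOver-cong xs (λ i → sym (trans (sumOver-single xs (δ i) (σ i) unique (complete _) (δ-off i)) (δ-on i (σ i) refl))) ⟩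
    sumOver xs (λ i → sumOver xs (δ i))           ≡⟨ sumOver-swap xs xs δ ⟩
    sumOver xs (λ j → sumOver xs (λ i → δ i j))   ≡⟨ sumOver-cong xs (λ j → sumOver-single xs (λ i → δ i j) (τ j) unique (complete _) (λ i i≢τj → δ-off i j (λ j≡σi → i≢τj (trans (sym (τσ i)) (cong τ (sym j≡σi)))))) ⟩
    sumOver xs (λ j → δ (τ j) j)                  ≡⟨ sumOver-cong xs (λ j → δ-on (τ j) j (sym (στ j))) ⟩
    sumOver xs f                                  ∎
    where
    δ : I → I → A
    δ i j with j ≟ σ i
    ... | yes _ = f j
    ... | no _ = 0#
    δ-off : ∀ i j → ¬ (j ≡ σ i) → δ i j ≡ 0#
    δ-off i j j≢σi with j ≟ σ i
    ... | yes j≡σi = ⊥-elim (j≢σi j≡σi)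
    ... | no _ = refl
    δ-on : ∀ i j → j ≡ σ i → δ i j ≡ f j
    δ-on i j j≡σi with j ≟ σ i
    ... | yes _ = refl
    ... | no j≢σi = ⊥-elim (j≢σi j≡σi)

  sumBelow : ℕ → (ℕ → A) → A
  sumBelow zero f = 0#
  sumBelow (suc n) f = sumBelow n f + f n

  sumBelow-cong : ∀ n {f g : ℕ → A} → (∀ i → i ℕ.< n → f i ≡ g i) → sumBelow n f ≡ sumBelow n g
  sumBelow-cong zero f≗g = refl
  sumBelow-cong (suc n) f≗g = cong₂ _+_ (sumBelow-cong n (λ i i<n → f≗g i (ℕ.m<n⇒m<1+n i<n))) (f≗g n ℕ.≤-refl)

  sumBelow-0 : ∀ n → sumBelow n (λ _ → 0#) ≡ 0#
  sumBelow-0 zero = refl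
  sumBelow-0 (suc n) = trans (+-identityʳ _) (sumBelow-0 n)

  sumBelow-+ : ∀ n f g → sumBelow n (λ i → f i + g i) ≡ sumBelow n f + sumBelow n g
  sumBelow-+ zero f g = sym (+-identityˡ 0#)
  sumBelow-+ (suc n) f g = trans (cong (_+ (f n + g n)) (sumBelow-+ n f g))
    (solve 4 (λ a b c d → (a :+ b) :+ (c :+ d) := (a :+ c) :+ (b :+ d)) refl _ _ _ _)

  sumBelow-neg : ∀ n f → sumBelow n (λ i → - f i) ≡ - sumBelow n f
  sumBelow-neg zero f = sym -0#≈0#
  sumBelow-neg (suc n) f = trans (cong (_+ - f n) (sumBelow-neg n f)) (-‿+-comm _ _)

  sumBelow-*ˡ : ∀ n c f → sumBelow n (λ i → c * f i) ≡ c * sumBelow n f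
  sumBelow-*ˡ zero c f = sym (zeroʳ c)
  sumBelow-*ˡ (suc n) c f = trans (cong (_+ c * f n) (sumBelow-*ˡ n c f)) (sym (distribˡ c _ _))

  sumBelow-*ʳ : ∀ n c f → sumBelow n (λ i → f i * c) ≡ sumBelow n f * c
  sumBelow-*ʳ n c f = trans (sumBelow-cong n (λ i _ → *-comm (f i) c)) (trans (sumBelow-*ˡ n c f) (*-comm c _))

  sumBelow-swap : ∀ n m (f : ℕ → ℕ → A) →
                  sumBelow n (λ i → sumBelow m (f i)) ≡ sumBelow m (λ j → sumBelow n (λ i → f i j))
  sumBelow-swap zero m f = sym (sumBelow-0 m)
  sumBelow-swap (suc n) m f = trans (cong (_+ sumBelow m (f n)) (sumBelow-swap n m f))
    (sym (sumBelow-+ m (λ j → sumBelow n (λ i → f i j)) (f n)))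

  sumBelow-suc : ∀ n f → sumBelow (suc n) f ≡ f 0 + sumBelow n (λ i → f (suc i))
  sumBelow-suc zero f = trans (+-identityˡ _) (sym (+-identityʳ _))
  sumBelow-suc (suc n) f = trans (cong (_+ f (suc n)) (sumBelow-suc n f)) (+-assoc _ _ _)

  Periodic : ℕ → (ℕ → A) → Set
  Periodic r f = ∀ i → f (i ℕ.+ r) ≡ f i

  module _ (r : ℕ) where

    sumBelow-rotate : ∀ f → Periodic r f → sumBelow r (λ i → f (suc i)) ≡ sumBelow r f
    sumBelow-rotate f periodic = begin
      sumBelow r (λ i → f (suc i))                      ≡⟨ solve 2 (λ a s → s := :- a :+ (a :+ s)) refl (f 0) _ ⟩
      - f 0 + (f 0 + sumBelow r (λ i → f (suc i)))      ≡⟨ cong (- f 0 +_) (sym (sumBelow-suc r f)) ⟩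
      - f 0 + (sumBelow r f + f r)                      ≡⟨ cong (λ z → - f 0 + (sumBelow r f + z)) (periodic 0) ⟩
      - f 0 + (sumBelow r f + f 0)                      ≡⟨ solve 2 (λ a s → :- a :+ (s :+ a) := s) refl (f 0) _ ⟩
      sumBelow r f                                      ∎

    sumBelow-shift : ∀ c f → Periodic r f → sumBelow r (λ i → f (i ℕ.+ c)) ≡ sumBelow r f
    sumBelow-shift zero f periodic = sumBelow-cong r (λ i _ → cong f (ℕ.+-identityʳ i))
    sumBelow-shift (suc c) f periodic = begin
      sumBelow r (λ i → f (i ℕ.+ suc c))   ≡⟨ sumBelow-cong r (λ i _ → cong f (ℕ.+-suc i c)) ⟩
      sumBelow r (λ i → f (suc i ℕ.+ c))   ≡⟨ sumBelow-rotate (λ i → f (i ℕ.+ c)) (λ i → trans (cong f (ℕ+.xy∙z≈xz∙y i r c)) (periodic (i ℕ.+ c))) ⟩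
      sumBelow r (λ i → f (i ℕ.+ c))       ≡⟨ sumBelow-shift c f periodic ⟩
      sumBelow r f                         ∎

    sumBelow-reflect : ∀ f → Periodic r f → sumBelow r (λ i → f (r ℕ.∸ i)) ≡ sumBelow r f
    sumBelow-reflect f periodic = trans (reverse r f) (sumBelow-rotate f periodic)
      where
      reverse : ∀ n g → sumBelow n (λ i → g (n ℕ.∸ i)) ≡ sumBelow n (λ i → g (suc i))
      reverse zero g = refl
      reverse (suc n) g = trans (sumBelow-suc n (λ i → g (suc n ℕ.∸ i))) (trans (cong (g (suc n) +_) (reverse n g)) (+-comm _ _))

-- The Gaussian integers

negᵢ : ℤi → ℤi
negᵢ (a +i b) = ℤ.- a +i ℤ.- b

private
  +i-cong : ∀ {a b c d} → a ≡ c → b ≡ d → (a +i b) ≡ (c +i d)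
  +i-cong refl refl = refl

  module ComponentIdentities where
    open import Data.Integer using (_+_; _*_; _-_; -_)

    *-assoc-re : ∀ a b c d e f → (a * c - b * d) * e - (a * d + b * c) * f ≡ a * (c * e - d * f) - b * (c * f + d * e)
    *-assoc-re = solve-∀
    *-assoc-im : ∀ a b c d e f → (a * c - b * d) * f + (a * d + b * c) * e ≡ a * (c * f + d * e) + b * (c * e - d * f)
    *-assoc-im = solve-∀
    *-comm-re : ∀ a b c d → a * c - b * d ≡ c * a - d * b
    *-comm-re = solve-∀
    *-comm-im : ∀ a b c d → a * d + b * c ≡ c * b + d * a
    *-comm-im = solve-∀
    *-identityˡ-re : ∀ a b → ℤ.1ℤ * a - ℤ.0ℤ * b ≡ a
    *-identityˡ-re = solve-∀
    *-identityˡ-im : ∀ a b → ℤ.1ℤ * b + ℤ.0ℤ * a ≡ b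
    *-identityˡ-im = solve-∀
    *-identityʳ-re : ∀ a b → a * ℤ.1ℤ - b * ℤ.0ℤ ≡ a
    *-identityʳ-re = solve-∀
    *-identityʳ-im : ∀ a b → a * ℤ.0ℤ + b * ℤ.1ℤ ≡ b
    *-identityʳ-im = solve-∀
    distribˡ-re : ∀ a b c d e f → a * (c + e) - b * (d + f) ≡ (a * c - b * d) + (a * e - b * f)
    distribˡ-re = solve-∀
    distribˡ-im : ∀ a b c d e f → a * (d + f) + b * (c + e) ≡ (a * d + b * c) + (a * f + b * e)
    distribˡ-im = solve-∀
    distribʳ-re : ∀ a b c d e f → (c + e) * a - (d + f) * b ≡ (c * a - d * b) + (e * a - f * b)
    distribʳ-re = solve-∀
    distribʳ-im : ∀ a b c d e f → (c + e) * b + (d + f) * a ≡ (c * b + d * a) + (e * b + f * a)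
    distribʳ-im = solve-∀
    conj-*-re : ∀ a b c d → a * c - b * d ≡ a * c - (- b) * (- d)
    conj-*-re = solve-∀
    conj-*-im : ∀ a b c d → - (a * d + b * c) ≡ a * (- d) + (- b) * c
    conj-*-im = solve-∀
    normSq-re : ∀ a b → a * a - b * (- b) ≡ a * a + b * b
    normSq-re = solve-∀
    normSq-im : ∀ a b → a * (- b) + b * a ≡ ℤ.0ℤ
    normSq-im = solve-∀

  open ComponentIdentities

ℤi-isCommutativeRing : IsCommutativeRing _≡_ _+ᵢ_ _*ᵢ_ negᵢ 0ᵢ 1ᵢ
ℤi-isCommutativeRing = record
  { isRing = record
    { +-isAbelianGroup = record
      { isGroup = record
        { isMonoid = record
          { isSemigroup = record
            { isMagma = record { isEquivalence = isEquivalence ; ∙-cong = cong₂ _+ᵢ_ }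
            ; assoc = λ { (a +i b) (c +i d) (e +i f) → +i-cong (ℤP.+-assoc a c e) (ℤP.+-assoc b d f) } }
          ; identity = (λ { (a +i b) → +i-cong (ℤP.+-identityˡ a) (ℤP.+-identityˡ b) })
                     , (λ { (a +i b) → +i-cong (ℤP.+-identityʳ a) (ℤP.+-identityʳ b) }) }
        ; inverse = (λ { (a +i b) → +i-cong (ℤP.+-inverseˡ a) (ℤP.+-inverseˡ b) })
                  , (λ { (a +i b) → +i-cong (ℤP.+-inverseʳ a) (ℤP.+-inverseʳ b) })
        ; ⁻¹-cong = cong negᵢ }
      ; comm = λ { (a +i b) (c +i d) → +i-cong (ℤP.+-comm a c) (ℤP.+-comm b d) } }
    ; *-cong = cong₂ _*ᵢ_
    ; *-assoc = λ { (a +i b) (c +i d) (e +i f) → +i-cong (*-assoc-re a b c d e f) (*-assoc-im a b c d e f) }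
    ; *-identity = (λ { (a +i b) → +i-cong (*-identityˡ-re a b) (*-identityˡ-im a b) })
                 , (λ { (a +i b) → +i-cong (*-identityʳ-re a b) (*-identityʳ-im a b) })
    ; distrib = (λ { (a +i b) (c +i d) (e +i f) → +i-cong (distribˡ-re a b c d e f) (distribˡ-im a b c d e f) })
              , (λ { (a +i b) (c +i d) (e +i f) → +i-cong (distribʳ-re a b c d e f) (distribʳ-im a b c d e f) }) }
  ; *-comm = λ { (a +i b) (c +i d) → +i-cong (*-comm-re a b c d) (*-comm-im a b c d) } }

module ℤ[i] = CommutativeRingProperties ℤi-isCommutativeRing

conjᵢ-+ : ∀ x y → conjᵢ (x +ᵢ y) ≡ conjᵢ x +ᵢ conjᵢ y
conjᵢ-+ (a +i b) (c +i d) = +i-cong refl (ℤP.neg-distrib-+ b d)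

conjᵢ-* : ∀ x y → conjᵢ (x *ᵢ y) ≡ conjᵢ x *ᵢ conjᵢ y
conjᵢ-* (a +i b) (c +i d) = +i-cong (conj-*-re a b c d) (conj-*-im a b c d)

conjᵢ-sumOver : {I : Set} (xs : List I) (f : I → ℤi) → conjᵢ (ℤ[i].sumOver xs f) ≡ ℤ[i].sumOver xs (λ i → conjᵢ (f i))
conjᵢ-sumOver [] f = refl
conjᵢ-sumOver (x ∷ xs) f = trans (conjᵢ-+ (f x) _) (cong (conjᵢ (f x) +ᵢ_) (conjᵢ-sumOver xs f))

*ᵢ-conjᵢ : ∀ x → x *ᵢ conjᵢ x ≡ normSq x +i ℤ.0ℤ
*ᵢ-conjᵢ (a +i b) = +i-cong (normSq-re a b) (normSq-im a b)

conjᵢ-powᵢ : ∀ x n → conjᵢ (powᵢ x n) ≡ powᵢ (conjᵢ x) n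
conjᵢ-powᵢ x zero = refl
conjᵢ-powᵢ x (suc n) = trans (conjᵢ-* x _) (cong (conjᵢ x *ᵢ_) (conjᵢ-powᵢ x n))

powᵢ≗^ : ∀ x n → powᵢ x n ≡ x ℤ[i].^ᴿ n
powᵢ≗^ x zero = refl
powᵢ≗^ x (suc n) = cong (x *ᵢ_) (powᵢ≗^ x n)

powᵢ-+ : ∀ x m n → powᵢ x (m ℕ.+ n) ≡ powᵢ x m *ᵢ powᵢ x n
powᵢ-+ x m n = trans (powᵢ≗^ x _) (trans (ℤ[i].^-homo-* x m n) (sym (cong₂ _*ᵢ_ (powᵢ≗^ x m) (powᵢ≗^ x n))))

powᵢ-* : ∀ x m n → powᵢ x (m ℕ.* n) ≡ powᵢ (powᵢ x m) n
powᵢ-* x m n = trans (powᵢ≗^ x _) (trans (sym (ℤ[i].^-assocʳ x m n)) (sym (trans (powᵢ≗^ _ n) (cong (ℤ[i]._^ᴿ n) (powᵢ≗^ x m)))))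

≡negᵢ⇒≡0ᵢ : ∀ x → x ≡ negᵢ x → x ≡ 0ᵢ
≡negᵢ⇒≡0ᵢ (a +i b) x≡-x = +i-cong (≡-⇒≡0 a (cong ℤi.re x≡-x)) (≡-⇒≡0 b (cong ℤi.im x≡-x))
  where
  ≡-⇒≡0 : ∀ a → a ≡ ℤ.- a → a ≡ ℤ.0ℤ
  ≡-⇒≡0 +0 _ = refl
  ≡-⇒≡0 +[1+ n ] ()
  ≡-⇒≡0 -[1+ n ] ()

module FourthRootOfUnity (ω : ℤi) (ω²≡-1 : ω *ᵢ ω ≡ -1ᵢ) where

  -- ω = ± i, as a nonzero real part would make ω² positive or ω² non-real.
  conjᵢ-ω : conjᵢ ω ≡ negᵢ ω
  conjᵢ-ω = purely-imaginary ω ω²≡-1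
    where
    purely-imaginary : ∀ w → w *ᵢ w ≡ -1ᵢ → conjᵢ w ≡ negᵢ w
    purely-imaginary (+0 +i b) _ = refl
    purely-imaginary (+[1+ m ] +i +0) w²≡-1 with () ← cong ℤi.re w²≡-1
    purely-imaginary (+[1+ m ] +i +[1+ n ]) w²≡-1 with () ← cong ℤi.im w²≡-1
    purely-imaginary (+[1+ m ] +i -[1+ n ]) w²≡-1 with () ← cong ℤi.im w²≡-1
    purely-imaginary (-[1+ m ] +i +0) w²≡-1 with () ← cong ℤi.re w²≡-1
    purely-imaginary (-[1+ m ] +i +[1+ n ]) w²≡-1 with () ← cong ℤi.im w²≡-1
    purely-imaginary (-[1+ m ] +i -[1+ n ]) w²≡-1 with () ← cong ℤi.im w²≡-1

  ω^_ : ℕ → ℤi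
  ω^ n = powᵢ ω n

  ω^-+ : ∀ m n → ω^ (m ℕ.+ n) ≡ ω^ m *ᵢ ω^ n
  ω^-+ = powᵢ-+ ω

  ω^2≡-1 : ω^ 2 ≡ -1ᵢ
  ω^2≡-1 = trans (cong (ω *ᵢ_) (ℤ[i].*-identityʳ ω)) ω²≡-1

  ω^[4*k]≡1 : ∀ k → ω^ (4 ℕ.* k) ≡ 1ᵢ
  ω^[4*k]≡1 k = begin
    ω^ (2 ℕ.* 2 ℕ.* k)     ≡⟨ powᵢ-* ω (2 ℕ.* 2) k ⟩
    powᵢ (ω^ (2 ℕ.* 2)) k  ≡⟨ cong (λ z → powᵢ z k) (trans (powᵢ-* ω 2 2) (cong (λ z → powᵢ z 2) ω^2≡-1)) ⟩
    powᵢ 1ᵢ k              ≡⟨ powᵢ-1ᵢ k ⟩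
    1ᵢ                     ∎
    where
    open ≡-Reasoning
    powᵢ-1ᵢ : ∀ k → powᵢ 1ᵢ k ≡ 1ᵢ
    powᵢ-1ᵢ zero = refl
    powᵢ-1ᵢ (suc k) = trans (ℤ[i].*-identityˡ _) (powᵢ-1ᵢ k)

  conjᵢ-ω^ : ∀ n → conjᵢ (ω^ n) ≡ ω^ (3 ℕ.* n)
  conjᵢ-ω^ n = begin
    conjᵢ (ω^ n)           ≡⟨ conjᵢ-powᵢ ω n ⟩
    powᵢ (conjᵢ ω) n       ≡⟨ cong (λ z → powᵢ z n) (trans conjᵢ-ω (sym ω^3≡-ω)) ⟩
    powᵢ (ω^ 3) n          ≡⟨ sym (powᵢ-* ω 3 n) ⟩
    ω^ (3 ℕ.* n)           ∎
    where
    open ≡-Reasoning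
    ω^3≡-ω : ω^ 3 ≡ negᵢ ω
    ω^3≡-ω = trans (ω^-+ 1 2) (trans (cong₂ _*ᵢ_ (ℤ[i].*-identityʳ ω) ω^2≡-1)
               (ℤ[i].solve 1 (λ w → w ℤ[i].:* ℤ[i].:- ℤ[i].con (ℤ.+ 1) ℤ[i].:= ℤ[i].:- w) refl ω))

  ω^-unit : ∀ n → ω^ n *ᵢ conjᵢ (ω^ n) ≡ 1ᵢ
  ω^-unit n = trans (cong (ω^ n *ᵢ_) (conjᵢ-ω^ n)) (trans (sym (ω^-+ n (3 ℕ.* n))) (ω^[4*k]≡1 n))

  normSq-ω^ : ∀ n → normSq (ω^ n) ≡ ℤ.+ 1
  normSq-ω^ n = cong ℤi.re (trans (sym (*ᵢ-conjᵢ (ω^ n))) (ω^-unit n))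

module FinCommRingProperties (K : FinCommRing) where

  open FinCommRing K public using (Carrier; pow; ι; two; sumFin; elems; elems-unique; elems-complete; _≟_)
  open CommutativeRingProperties (FinCommRing.isCommutativeRing K) public
  open ≡-Reasoning

  ι≗×1# : ∀ n → ι n ≡ n × 1#
  ι≗×1# zero = refl
  ι≗×1# (suc n) = cong (1# +_) (ι≗×1# n)

  ι-+ : ∀ m n → ι (m ℕ.+ n) ≡ ι m + ι n
  ι-+ m n = trans (ι≗×1# (m ℕ.+ n)) (trans (×-homo-+ 1# m n) (sym (cong₂ _+_ (ι≗×1# m) (ι≗×1# n))))

  ι-* : ∀ m n → ι (m ℕ.* n) ≡ ι m * ι n
  ι-* m n = trans (ι≗×1# (m ℕ.* n)) (trans (×1-homo-* m n) (sym (cong₂ _*_ (ι≗×1# m) (ι≗×1# n))))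

  x+x≡two*x : ∀ x → x + x ≡ two * x
  x+x≡two*x x = sym (trans (distribʳ x 1# 1#) (cong₂ _+_ (*-identityˡ x) (*-identityˡ x)))

  pow≗^ : ∀ x n → pow x n ≡ x ^ᴿ n
  pow≗^ x zero = refl
  pow≗^ x (suc n) = cong (x *_) (pow≗^ x n)

  pow-+ : ∀ x m n → pow x (m ℕ.+ n) ≡ pow x m * pow x n
  pow-+ x m n = trans (pow≗^ x (m ℕ.+ n)) (trans (^-homo-* x m n) (sym (cong₂ _*_ (pow≗^ x m) (pow≗^ x n))))

  pow-* : ∀ x m n → pow x (m ℕ.* n) ≡ pow (pow x m) n
  pow-* x m n = trans (pow≗^ x (m ℕ.* n)) (trans (sym (^-assocʳ x m n)) (sym (trans (pow≗^ _ n) (cong (_^ᴿ n) (pow≗^ x m)))))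

  pow-distrib-* : ∀ x y n → pow (x * y) n ≡ pow x n * pow y n
  pow-distrib-* x y n = trans (pow≗^ (x * y) n) (trans (^-distrib-* x y n) (sym (cong₂ _*_ (pow≗^ x n) (pow≗^ y n))))

  pow-1# : ∀ n → pow 1# n ≡ 1#
  pow-1# zero = refl
  pow-1# (suc n) = trans (*-identityˡ _) (pow-1# n)

  pow-2^-suc : ∀ x n → pow x (2 ^ suc n) ≡ pow x (2 ^ n) * pow x (2 ^ n)
  pow-2^-suc x n = trans (pow-+ x (2 ^ n) _) (cong (λ k → pow x (2 ^ n) * pow x k) (ℕ.+-identityʳ (2 ^ n)))

  pow-2^-+ : ∀ x n k → pow x (2 ^ (n ℕ.+ k)) ≡ pow (pow x (2 ^ n)) (2 ^ k)
  pow-2^-+ x n k = trans (cong (pow x) (ℕ.^-distribˡ-+-* 2 n k)) (pow-* x (2 ^ n) (2 ^ k))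

  pow-0#-2^ : ∀ n → pow 0# (2 ^ n) ≡ 0#
  pow-0#-2^ zero = zeroˡ 1#
  pow-0#-2^ (suc n) = trans (pow-2^-suc 0# n) (trans (cong (_* pow 0# (2 ^ n)) (pow-0#-2^ n)) (zeroˡ _))

  sumFin≗sumBelow : ∀ n (g : ℕ → Carrier) → sumFin n (λ i → g (toℕ i)) ≡ sumBelow n g
  sumFin≗sumBelow zero g = refl
  sumFin≗sumBelow (suc n) g = begin
    g 0 + foldr _+_ 0# (map (λ i → g (toℕ i)) (tabulate {n = n} Fin.suc))  ≡⟨ cong (λ l → g 0 + foldr _+_ 0# l) shift-index ⟩
    g 0 + sumFin n (λ i → g (suc (toℕ i)))                               ≡⟨ cong (g 0 +_) (sumFin≗sumBelow n (λ i → g (suc i))) ⟩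
    g 0 + sumBelow n (λ i → g (suc i))                                   ≡⟨ sym (sumBelow-suc n g) ⟩
    sumBelow (suc n) g                                                   ∎
    where
    shift-index : map (λ i → g (toℕ i)) (tabulate {n = n} Fin.suc) ≡ map (λ i → g (suc (toℕ i))) (allFin n)
    shift-index = trans (List.map-tabulate Fin.suc _) (sym (List.map-tabulate id _))

module CharacteristicTwo (K : FinCommRing) (two≡0# : FinCommRing.two K ≡ FinCommRing.0# K) where

  open FinCommRingProperties K
  open ≡-Reasoning

  x+x≡0# : ∀ x → x + x ≡ 0#
  x+x≡0# x = trans (x+x≡two*x x) (trans (cong (_* x) two≡0#) (zeroˡ x))

  -x≡x : ∀ x → - x ≡ x
  -x≡x x = sym (+-inverseʳ-unique x x (x+x≡0# x))

  square-+ : ∀ x y → (x + y) * (x + y) ≡ x * x + y * y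
  square-+ x y = begin
    (x + y) * (x + y)                 ≡⟨ solve 2 (λ a b → (a :+ b) :* (a :+ b) := a :* a :+ b :* b :+ (a :* b :+ a :* b)) refl x y ⟩
    x * x + y * y + (x * y + x * y)   ≡⟨ cong (x * x + y * y +_) (x+x≡0# (x * y)) ⟩
    x * x + y * y + 0#                ≡⟨ +-identityʳ _ ⟩
    x * x + y * y                     ∎

  frobenius-+ : ∀ x y n → pow (x + y) (2 ^ n) ≡ pow x (2 ^ n) + pow y (2 ^ n)
  frobenius-+ x y zero = trans (*-identityʳ _) (sym (cong₂ _+_ (*-identityʳ x) (*-identityʳ y)))
  frobenius-+ x y (suc n) = begin
    pow (x + y) (2 ^ suc n)                                        ≡⟨ pow-2^-suc (x + y) n ⟩
    pow (x + y) (2 ^ n) * pow (x + y) (2 ^ n)                      ≡⟨ cong (λ z → z * z) (frobenius-+ x y n) ⟩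
    (pow x (2 ^ n) + pow y (2 ^ n)) * (pow x (2 ^ n) + pow y (2 ^ n)) ≡⟨ square-+ _ _ ⟩
    pow x (2 ^ n) * pow x (2 ^ n) + pow y (2 ^ n) * pow y (2 ^ n)  ≡⟨ sym (cong₂ _+_ (pow-2^-suc x n) (pow-2^-suc y n)) ⟩
    pow x (2 ^ suc n) + pow y (2 ^ suc n)                          ∎

  sumBelow-square : ∀ n f → sumBelow n f * sumBelow n f ≡ sumBelow n (λ k → f k * f k)
  sumBelow-square zero f = zeroˡ 0#
  sumBelow-square (suc n) f = trans (square-+ _ _) (cong (_+ f n * f n) (sumBelow-square n f))

  trace : ℕ → Carrier → Carrier
  trace r u = sumBelow r (λ k → pow u (2 ^ k))

  absTr≡trace : ∀ r u → absTr K r u ≡ trace r u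
  absTr≡trace r u = sumFin≗sumBelow r (λ k → pow u (2 ^ k))

  trace-+ : ∀ r x y → trace r (x + y) ≡ trace r x + trace r y
  trace-+ r x y = trans (sumBelow-cong r (λ k _ → frobenius-+ x y k)) (sumBelow-+ r _ _)

  trace-0# : ∀ r → trace r 0# ≡ 0#
  trace-0# r = trans (sumBelow-cong r (λ k _ → pow-0#-2^ k)) (sumBelow-0 r)

  trace-sumBelow : ∀ r n f → trace r (sumBelow n f) ≡ sumBelow n (λ i → trace r (f i))
  trace-sumBelow r zero f = trace-0# r
  trace-sumBelow r (suc n) f = trans (trace-+ r _ _) (cong (_+ trace r (f n)) (trace-sumBelow r n f))

module FiniteFieldOfCharacteristicTwo
  (K : FinCommRing) {q : ℕ} (isField : IsFieldOfOrder K q)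
  (two≡0# : FinCommRing.two K ≡ FinCommRing.0# K) where

  open FinCommRingProperties K
  open CharacteristicTwo K two≡0#
  open IsFieldOfOrder isField
  open ≡-Reasoning

  x*y≡0⇒x≡0 : ∀ x y → x * y ≡ 0# → ¬ (y ≡ 0#) → x ≡ 0#
  x*y≡0⇒x≡0 x y xy≡0 y≢0 with inverse y y≢0
  ... | y⁻¹ , yy⁻¹≡1 = begin
    x               ≡⟨ sym (*-identityʳ x) ⟩
    x * 1#          ≡⟨ cong (x *_) (sym yy⁻¹≡1) ⟩
    x * (y * y⁻¹)   ≡⟨ sym (*-assoc x y y⁻¹) ⟩
    x * y * y⁻¹     ≡⟨ cong (_* y⁻¹) xy≡0 ⟩
    0# * y⁻¹        ≡⟨ zeroˡ y⁻¹ ⟩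
    0#              ∎

  idempotent⇒≡1# : ∀ t → t * t ≡ t → ¬ (t ≡ 0#) → t ≡ 1#
  idempotent⇒≡1# t tt≡t t≢0 = x∙y⁻¹≈ε⇒x≈y t 1# (x*y≡0⇒x≡0 _ t [t-1]t≡0 t≢0)
    where
    [t-1]t≡0 : (t + - 1#) * t ≡ 0#
    [t-1]t≡0 = begin
      (t + - 1#) * t      ≡⟨ solve 2 (λ t o → (t :+ :- o) :* t := t :* t :+ :- (o :* t)) refl t 1# ⟩
      t * t + - (1# * t)  ≡⟨ cong₂ (λ a b → a + - b) tt≡t (*-identityˡ t) ⟩
      t + - t             ≡⟨ -‿inverseʳ t ⟩
      0#                  ∎

  module _ (r : ℕ) where

    trace-idempotent : (∀ x → pow x (2 ^ r) ≡ x) → ∀ u → trace r u * trace r u ≡ trace r u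
    trace-idempotent pow-2^r u = begin
      trace r u * trace r u                              ≡⟨ sumBelow-square r _ ⟩
      sumBelow r (λ k → pow u (2 ^ k) * pow u (2 ^ k))   ≡⟨ sumBelow-cong r (λ k _ → sym (pow-2^-suc u k)) ⟩
      sumBelow r (λ k → pow u (2 ^ suc k))               ≡⟨ sumBelow-rotate r (λ k → pow u (2 ^ k)) (λ k → trans (pow-2^-+ u k r) (pow-2^r _)) ⟩
      trace r u                                          ∎

    -- Artin's independence of the Frobenius powers u ↦ u^(2^b), b < r, using an element y
    -- on which they take pairwise distinct values.
    module FrobeniusIndependence
      (y : Carrier) (separating : ∀ b n → b ℕ.< n → n ℕ.< r → ¬ (pow y (2 ^ b) ≡ pow y (2 ^ n))) where

      private
        -- Σ c_b (y^(2^b) - y^(2^n)) u^(2^b) = L(y u) - y^(2^n) L(u), in which the top term cancels.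
        eliminate-top : ∀ n (c : ℕ → Carrier) → (∀ u → sumBelow (suc n) (λ b → c b * pow u (2 ^ b)) ≡ 0#) →
                        ∀ u → sumBelow n (λ b → c b * (pow y (2 ^ b) + - pow y (2 ^ n)) * pow u (2 ^ b)) ≡ 0#
        eliminate-top n c vanish u = begin
          sumBelow n (λ b → c b * (Y b + - Y n) * pow u (2 ^ b))        ≡⟨ sumBelow-cong n (λ b _ → expand b) ⟩
          sumBelow n (λ b → c b * pow (y * u) (2 ^ b) + - (Y n * (c b * pow u (2 ^ b))))
                                                                         ≡⟨ trans (sumBelow-+ n _ _) (cong (L (y * u) +_) (trans (sumBelow-neg n _) (cong -_ (sumBelow-*ˡ n (Y n) _)))) ⟩
          L (y * u) + - (Y n * L u)                                      ≡⟨ cong₂ (λ s t → s + - (Y n * t)) (L≡ (y * u)) (L≡ u) ⟩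
          - (c n * pow (y * u) (2 ^ n)) + - (Y n * - (c n * pow u (2 ^ n))) ≡⟨ cong (λ t → - (c n * t) + - (Y n * - (c n * pow u (2 ^ n)))) (pow-distrib-* y u (2 ^ n)) ⟩
          - (c n * (Y n * pow u (2 ^ n))) + - (Y n * - (c n * pow u (2 ^ n)))
                                                                         ≡⟨ solve 3 (λ a v p → :- (a :* (v :* p)) :+ :- (v :* :- (a :* p)) := con (ℤ.+ 0)) refl (c n) (Y n) (pow u (2 ^ n)) ⟩
          0#                                                             ∎
          where
          Y : ℕ → Carrier
          Y b = pow y (2 ^ b)
          L : Carrier → Carrier
          L u = sumBelow n (λ b → c b * pow u (2 ^ b))
          L≡ : ∀ u → L u ≡ - (c n * pow u (2 ^ n))
          L≡ u = +-inverseʳ-unique _ _ (trans (+-comm _ _) (vanish u))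
          expand : ∀ b → c b * (Y b + - Y n) * pow u (2 ^ b) ≡ c b * pow (y * u) (2 ^ b) + - (Y n * (c b * pow u (2 ^ b)))
          expand b = trans
            (solve 4 (λ cb yb yn ub → cb :* (yb :+ :- yn) :* ub := cb :* (yb :* ub) :+ :- (yn :* (cb :* ub))) refl (c b) (Y b) (Y n) (pow u (2 ^ b)))
            (cong (λ t → c b * t + - (Y n * (c b * pow u (2 ^ b)))) (sym (pow-distrib-* y u (2 ^ b))))

      frobenius-independent : ∀ n → n ℕ.≤ r → (c : ℕ → Carrier) →
        (∀ u → sumBelow n (λ b → c b * pow u (2 ^ b)) ≡ 0#) → ∀ b → b ℕ.< n → c b ≡ 0#
      frobenius-independent zero _ c vanish b ()
      frobenius-independent (suc n) n<r c vanish b b<1+n =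
        [ lower b , (λ b≡n → subst (λ t → c t ≡ 0#) (sym b≡n) top) ]′ (ℕ.m<1+n⇒m<n∨m≡n b<1+n)
        where
        lower : ∀ b → b ℕ.< n → c b ≡ 0#
        lower b b<n = x*y≡0⇒x≡0 (c b) _
          (frobenius-independent n (ℕ.<⇒≤ n<r) (λ b → c b * (pow y (2 ^ b) + - pow y (2 ^ n))) (eliminate-top n c vanish) b b<n)
          (λ yᵇ-yⁿ≡0 → separating b n b<n n<r (x∙y⁻¹≈ε⇒x≈y _ _ yᵇ-yⁿ≡0))
        top : c n ≡ 0#
        top = begin
          c n                                                      ≡⟨ sym (trans (cong (c n *_) (pow-1# (2 ^ n))) (*-identityʳ (c n))) ⟩
          c n * pow 1# (2 ^ n)                                     ≡⟨ sym (+-identityˡ _) ⟩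
          0# + c n * pow 1# (2 ^ n)                                ≡⟨ cong (_+ c n * pow 1# (2 ^ n)) (sym lower-terms) ⟩
          sumBelow n (λ b → c b * pow 1# (2 ^ b)) + c n * pow 1# (2 ^ n) ≡⟨ vanish 1# ⟩
          0#                                                       ∎
          where
          lower-terms : sumBelow n (λ b → c b * pow 1# (2 ^ b)) ≡ 0#
          lower-terms = trans (sumBelow-cong n (λ b b<n → trans (cong (_* pow 1# (2 ^ b)) (lower b b<n)) (zeroˡ _))) (sumBelow-0 n)

      frobenius-coefficients-unique : (c d : ℕ → Carrier) →
        (∀ u → sumBelow r (λ b → c b * pow u (2 ^ b)) ≡ sumBelow r (λ b → d b * pow u (2 ^ b))) →
        ∀ b → b ℕ.< r → c b ≡ d b
      frobenius-coefficients-unique c d same b b<r =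
        x∙y⁻¹≈ε⇒x≈y _ _ (frobenius-independent r ℕ.≤-refl (λ b → c b + - d b) difference-vanishes b b<r)
        where
        difference-vanishes : ∀ u → sumBelow r (λ b → (c b + - d b) * pow u (2 ^ b)) ≡ 0#
        difference-vanishes u = begin
          sumBelow r (λ b → (c b + - d b) * pow u (2 ^ b))
            ≡⟨ sumBelow-cong r (λ b _ → solve 3 (λ c d u → (c :+ :- d) :* u := c :* u :+ :- (d :* u)) refl (c b) (d b) _) ⟩
          sumBelow r (λ b → c b * pow u (2 ^ b) + - (d b * pow u (2 ^ b)))
            ≡⟨ trans (sumBelow-+ r _ _) (cong₂ _+_ (same u) (sumBelow-neg r _)) ⟩
          sumBelow r (λ b → d b * pow u (2 ^ b)) + - sumBelow r (λ b → d b * pow u (2 ^ b))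
            ≡⟨ -‿inverseʳ _ ⟩
          0# ∎

      -- The trace is a nonzero sum of Frobenius powers, hence not identically zero;
      -- being idempotent, it takes the value 1.
      trace-nondegenerate : 0 ℕ.< r → (∀ x → pow x (2 ^ r) ≡ x) →
                            ∀ c → ¬ (c ≡ 0#) → ∃ λ u → trace r (u * c) ≡ 1#
      trace-nondegenerate 0<r pow-2^r c c≢0 with all? (λ u → trace r u ≟ 0#) elems | inverse c c≢0
      ... | yes trace≡0 | _ = ⊥-elim (0≢1 (sym (frobenius-independent r ℕ.≤-refl (λ _ → 1#) trace-vanishes 0 0<r)))
        where
        trace-vanishes : ∀ u → sumBelow r (λ b → 1# * pow u (2 ^ b)) ≡ 0#
        trace-vanishes u = trans (sumBelow-cong r (λ b _ → *-identityˡ _)) (All.lookup trace≡0 (elems-complete u))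
      ... | no ¬trace≡0 | c⁻¹ , cc⁻¹≡1 with Any.satisfied (¬All⇒Any¬ (λ u → trace r u ≟ 0#) elems ¬trace≡0)
      ...   | u , tr[u]≢0 = u * c⁻¹ , (begin
        trace r (u * c⁻¹ * c)     ≡⟨ cong (trace r) (trans (*-assoc u c⁻¹ c) (trans (cong (u *_) (trans (*-comm c⁻¹ c) cc⁻¹≡1)) (*-identityʳ u))) ⟩
        trace r u                 ≡⟨ idempotent⇒≡1# _ (trace-idempotent pow-2^r u) tr[u]≢0 ⟩
        1#                        ∎)

module GaloisRing
  (r₀ : ℕ) (F R : FinCommRing) (π : Car R → Car F) (isGaloisRing : IsGaloisRing4 (suc r₀) F R π)
  (C : CyclicGen (suc r₀) R) (hat : Car F → Car R) (isTeichLift : IsTeichLift F R π C hat) where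

  r q : ℕ
  r = suc r₀
  q = 2 ^ r

  module F = FinCommRingProperties F
  open FinCommRingProperties R
  open IsGaloisRing4 isGaloisRing using (char4; char≢2; π-kernel)
  open IsGaloisRing4 isGaloisRing public using (π-+; π-*; π-1)
  open CyclicGen C using (g)
  open ≡-Reasoning

  π-0# : π 0# ≡ F.0#
  π-0# = F.x+x≈x⇒x≈0 _ (trans (sym (π-+ 0# 0#)) (cong π (+-identityʳ 0#)))

  π-neg : ∀ x → π (- x) ≡ F.- π x
  π-neg x = F.+-inverseʳ-unique (π x) (π (- x)) (trans (sym (π-+ x (- x))) (trans (cong π (-‿inverseʳ x)) π-0#))

  π-pow : ∀ x n → π (pow x n) ≡ F.pow (π x) n
  π-pow x zero = π-1
  π-pow x (suc n) = trans (π-* x (pow x n)) (cong (π x F.*_) (π-pow x n))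

  π-sumBelow : ∀ n f → π (sumBelow n f) ≡ F.sumBelow n (λ i → π (f i))
  π-sumBelow zero f = π-0#
  π-sumBelow (suc n) f = trans (π-+ _ _) (cong (F._+ π (f n)) (π-sumBelow n f))

  π≡0⇒∈2R : ∀ x → π x ≡ F.0# → ∃ λ y → x ≡ two * y
  π≡0⇒∈2R x = Equivalence.to (π-kernel x)

  π-two : π two ≡ F.0#
  π-two = Equivalence.from (π-kernel two) (1# , sym (*-identityʳ two))

  F-two≡0# : F.two ≡ F.0#
  F-two≡0# = trans (sym (trans (π-+ 1# 1#) (cong₂ F._+_ π-1 π-1))) π-two

  module F₂ = CharacteristicTwo F F-two≡0#

  two*two≡0# : two * two ≡ 0#
  two*two≡0# = begin
    two * two                                           ≡⟨ solve 1 (λ o → (o :+ o) :* (o :+ o) := o :* o :+ (o :* o :+ (o :* o :+ (o :* o :+ con (ℤ.+ 0))))) refl 1# ⟩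
    1# * 1# + (1# * 1# + (1# * 1# + (1# * 1# + 0#)))    ≡⟨ cong (λ t → t + (t + (t + (t + 0#)))) (*-identityˡ 1#) ⟩
    ι 4                                                 ≡⟨ char4 ⟩
    0#                                                  ∎

  two*[two*x]≡0# : ∀ x → two * (two * x) ≡ 0#
  two*[two*x]≡0# x = trans (sym (*-assoc two two x)) (trans (cong (_* x) two*two≡0#) (zeroˡ x))

  two*x+two*x≡0# : ∀ x → two * x + two * x ≡ 0#
  two*x+two*x≡0# x = trans (x+x≡two*x (two * x)) (two*[two*x]≡0# x)

  -[two*x]≡two*x : ∀ x → - (two * x) ≡ two * x
  -[two*x]≡two*x x = sym (+-inverseʳ-unique (two * x) (two * x) (two*x+two*x≡0# x))

  π≡⇒two*≡ : ∀ x y → π x ≡ π y → two * x ≡ two * y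
  π≡⇒two*≡ x y πx≡πy with π≡0⇒∈2R (x + - y) (trans (π-+ x (- y)) (trans (cong₂ F._+_ πx≡πy (π-neg y)) (F.-‿inverseʳ (π y))))
  ... | z , x-y≡2z = begin
    two * x                   ≡⟨ cong (two *_) (solve 2 (λ x y → x := (x :+ :- y) :+ y) refl x y) ⟩
    two * ((x + - y) + y)     ≡⟨ cong (λ t → two * (t + y)) x-y≡2z ⟩
    two * (two * z + y)       ≡⟨ distribˡ two _ y ⟩
    two * (two * z) + two * y ≡⟨ cong (_+ two * y) (two*[two*x]≡0# z) ⟩
    0# + two * y              ≡⟨ +-identityˡ _ ⟩
    two * y                   ∎

  π≡0⇒two*≡0# : ∀ x → π x ≡ F.0# → two * x ≡ 0#
  π≡0⇒two*≡0# x πx≡0 = trans (π≡⇒two*≡ x 0# (trans πx≡0 (sym π-0#))) (zeroʳ two)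

  square-+two* : ∀ x y → (x + two * y) * (x + two * y) ≡ x * x
  square-+two* x y = begin
    (x + two * y) * (x + two * y)                               ≡⟨ solve 3 (λ x y t → (x :+ t :* y) :* (x :+ t :* y) := x :* x :+ (t :* (t :* (y :* y)) :+ (t :* (x :* y) :+ t :* (x :* y)))) refl x y two ⟩
    x * x + (two * (two * (y * y)) + (two * (x * y) + two * (x * y))) ≡⟨ cong₂ (λ a b → x * x + (a + b)) (two*[two*x]≡0# _) (two*x+two*x≡0# _) ⟩
    x * x + (0# + 0#)                                           ≡⟨ trans (cong (x * x +_) (+-identityˡ 0#)) (+-identityʳ _) ⟩
    x * x                                                       ∎

  pow-2^-+two* : ∀ x y n → pow (x + two * y) (2 ^ suc n) ≡ pow x (2 ^ suc n)
  pow-2^-+two* x y n = begin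
    pow (x + two * y) (2 ^ (1 ℕ.+ n))   ≡⟨ pow-2^-+ _ 1 n ⟩
    pow (pow (x + two * y) 2) (2 ^ n)   ≡⟨ cong (λ t → pow t (2 ^ n)) (trans (pow-2 _) (trans (square-+two* x y) (sym (pow-2 x)))) ⟩
    pow (pow x 2) (2 ^ n)               ≡⟨ sym (pow-2^-+ x 1 n) ⟩
    pow x (2 ^ (1 ℕ.+ n))               ∎
    where pow-2 : ∀ x → pow x 2 ≡ x * x
          pow-2 x = cong (x *_) (*-identityʳ x)

  -- Teichmüller elements

  IsTeich : Car R → Set
  IsTeich = InTeich R C

  teich-0# : IsTeich 0#
  teich-0# = inj₁ refl

  teich-* : ∀ {s t} → IsTeich s → IsTeich t → IsTeich (s * t)
  teich-* (inj₁ refl) _ = inj₁ (zeroˡ _)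
  teich-* (inj₂ _) (inj₁ refl) = inj₁ (zeroʳ _)
  teich-* (inj₂ (k , refl)) (inj₂ (l , refl)) = inj₂ (k ℕ.+ l , sym (pow-+ g k l))

  teich-pow : ∀ {t} n → IsTeich t → IsTeich (pow t n)
  teich-pow zero _ = inj₂ (0 , refl)
  teich-pow (suc n) t∈𝒯 = teich-* t∈𝒯 (teich-pow n t∈𝒯)

  teich-pow-q : ∀ {t} → IsTeich t → pow t q ≡ t
  teich-pow-q (inj₁ refl) = pow-0#-2^ r
  teich-pow-q (inj₂ (k , refl)) = begin
    pow (pow g k) q     ≡⟨ sym (pow-* g k q) ⟩
    pow g (k ℕ.* q)     ≡⟨ cong (pow g) (ℕ.*-comm k q) ⟩
    pow g (q ℕ.* k)     ≡⟨ pow-* g q k ⟩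
    pow (pow g q) k     ≡⟨ cong (λ t → pow t k) g^q≡g ⟩
    pow g k             ∎
    where
    g^q≡g : pow g q ≡ g
    g^q≡g = trans (cong (pow g) (sym (ℕ.suc-pred q {{ℕ.m^n≢0 2 r}}))) (trans (cong (g *_) (CyclicGen.g-order C)) (*-identityʳ g))

  teich-pow-2^-periodic : ∀ {t} → IsTeich t → ∀ n → pow t (2 ^ (n ℕ.+ r)) ≡ pow t (2 ^ n)
  teich-pow-2^-periodic t∈𝒯 n = trans (pow-2^-+ _ n r) (teich-pow-q (teich-pow (2 ^ n) t∈𝒯))

  -- A Teichmüller element is its own q-th power, and q-th powers only see residues mod 2.
  teich-injective : ∀ {s t} → IsTeich s → IsTeich t → π s ≡ π t → s ≡ t
  teich-injective {s} {t} s∈𝒯 t∈𝒯 πs≡πt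
    with π≡0⇒∈2R (t + - s) (trans (π-+ t (- s)) (trans (cong₂ F._+_ (sym πs≡πt) (π-neg s)) (F.-‿inverseʳ (π s))))
  ... | y , t-s≡2y = begin
    s                           ≡⟨ sym (teich-pow-q s∈𝒯) ⟩
    pow s q                     ≡⟨ sym (pow-2^-+two* s y r₀) ⟩
    pow (s + two * y) q         ≡⟨ cong (λ z → pow (s + z) q) (sym t-s≡2y) ⟩
    pow (s + (t + - s)) q       ≡⟨ cong (λ z → pow z q) (solve 2 (λ s t → s :+ (t :+ :- s) := t) refl s t) ⟩
    pow t q                     ≡⟨ teich-pow-q t∈𝒯 ⟩
    t                           ∎

  π-hat : ∀ u → π (hat u) ≡ u
  π-hat u = proj₂ (isTeichLift u)

  hat-teich : ∀ u → IsTeich (hat u)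
  hat-teich u = proj₁ (isTeichLift u)

  hat-π : ∀ {t} → IsTeich t → hat (π t) ≡ t
  hat-π t∈𝒯 = teich-injective (hat-teich _) t∈𝒯 (π-hat _)

  hat-pow : ∀ u n → hat (F.pow u n) ≡ pow (hat u) n
  hat-pow u n = teich-injective (hat-teich _) (teich-pow n (hat-teich u))
    (trans (π-hat _) (sym (trans (π-pow _ n) (cong (λ z → F.pow z n) (π-hat u)))))

  teich-decomposition : ∀ x → ∃ λ y → x ≡ hat (π x) + two * y
  teich-decomposition x
    with π≡0⇒∈2R (x + - hat (π x)) (trans (π-+ _ _) (trans (cong (π x F.+_) (trans (π-neg _) (cong F.-_ (π-hat (π x))))) (F.-‿inverseʳ (π x))))
  ... | y , x-x̂≡2y = y , trans (solve 2 (λ x h → x := h :+ (x :+ :- h)) refl x (hat (π x))) (cong (hat (π x) +_) x-x̂≡2y)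

  F-pow-q : ∀ x → F.pow x q ≡ x
  F-pow-q x = begin
    F.pow x q             ≡⟨ cong (λ z → F.pow z q) (sym (π-hat x)) ⟩
    F.pow (π (hat x)) q   ≡⟨ sym (π-pow _ q) ⟩
    π (pow (hat x) q)     ≡⟨ cong π (teich-pow-q (hat-teich x)) ⟩
    π (hat x)             ≡⟨ π-hat x ⟩
    x                     ∎

  -- Uses that g has multiplicative order exactly 2^r - 1.
  generator-separating : ∀ b n → b ℕ.< n → n ℕ.< r → ¬ (F.pow (π g) (2 ^ b) ≡ F.pow (π g) (2 ^ n))
  generator-separating b n b<n n<r gᴮ≡gᴺ =
    CyclicGen.g-primitive C (N ℕ.∸ B) (ℕ.m<n⇒0<n∸m B<N) N∸B<q∸1 g^[N∸B]≡1
    where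
    B N : ℕ
    B = 2 ^ b
    N = 2 ^ n
    B<N : B ℕ.< N
    B<N = ℕ.^-monoʳ-< 2 (ℕ.s≤s (ℕ.s≤s ℕ.z≤n)) b<n
    N∸B<q∸1 : N ℕ.∸ B ℕ.< q ℕ.∸ 1
    N∸B<q∸1 = ℕ.≤-<-trans (ℕ.∸-monoʳ-≤ N (ℕ.m^n>0 2 b))
                (ℕ.∸-monoˡ-< (ℕ.^-monoʳ-< 2 (ℕ.s≤s (ℕ.s≤s ℕ.z≤n)) n<r) (ℕ.m^n>0 2 n))
    g⁻¹ : Car R
    g⁻¹ = pow g (q ℕ.∸ 2)
    g*g⁻¹≡1# : g * g⁻¹ ≡ 1#
    g*g⁻¹≡1# = trans (cong (pow g) (sym (∸1≡1+∸2 q (ℕ.*-monoʳ-≤ 2 (ℕ.m^n>0 2 r₀))))) (CyclicGen.g-order C)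
      where ∸1≡1+∸2 : ∀ m → 2 ℕ.≤ m → m ℕ.∸ 1 ≡ suc (m ℕ.∸ 2)
            ∸1≡1+∸2 (suc (suc m)) _ = refl
            ∸1≡1+∸2 (suc zero) (ℕ.s≤s ())
    gᴮ⁻¹*gᴮ≡1# : pow g⁻¹ B * pow g B ≡ 1#
    gᴮ⁻¹*gᴮ≡1# = trans (sym (pow-distrib-* g⁻¹ g B)) (trans (cong (λ t → pow t B) (trans (*-comm g⁻¹ g) g*g⁻¹≡1#)) (pow-1# B))
    g^[N∸B]≡1 : pow g (N ℕ.∸ B) ≡ 1#
    g^[N∸B]≡1 = begin
      pow g (N ℕ.∸ B)                          ≡⟨ sym (*-identityˡ _) ⟩
      1# * pow g (N ℕ.∸ B)                     ≡⟨ cong (_* pow g (N ℕ.∸ B)) (sym gᴮ⁻¹*gᴮ≡1#) ⟩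
      pow g⁻¹ B * pow g B * pow g (N ℕ.∸ B)    ≡⟨ *-assoc _ _ _ ⟩
      pow g⁻¹ B * (pow g B * pow g (N ℕ.∸ B))  ≡⟨ cong (pow g⁻¹ B *_) (sym (pow-+ g B (N ℕ.∸ B))) ⟩
      pow g⁻¹ B * pow g (B ℕ.+ (N ℕ.∸ B))      ≡⟨ cong (λ k → pow g⁻¹ B * pow g k) (ℕ.m+[n∸m]≡n (ℕ.<⇒≤ B<N)) ⟩
      pow g⁻¹ B * pow g N                      ≡⟨ cong (pow g⁻¹ B *_) (sym gᴮ≡gᴺ′) ⟩
      pow g⁻¹ B * pow g B                      ≡⟨ gᴮ⁻¹*gᴮ≡1# ⟩
      1#                                       ∎
      where
      g∈𝒯 : IsTeich g
      g∈𝒯 = inj₂ (1 , sym (*-identityʳ g))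
      gᴮ≡gᴺ′ : pow g B ≡ pow g N
      gᴮ≡gᴺ′ = teich-injective (teich-pow B g∈𝒯) (teich-pow N g∈𝒯) (trans (π-pow g B) (trans gᴮ≡gᴺ (sym (π-pow g N))))

  private
    1#≢0# : ¬ (1# ≡ 0#)
    1#≢0# 1≡0 = char≢2 (trans (cong (λ t → t + (t + 0#)) 1≡0) (trans (+-identityˡ _) (+-identityˡ _)))

  ι≡0#⇒4∣ : ∀ d → ι d ≡ 0# → ∃ λ k → d ≡ 4 ℕ.* k
  ι≡0#⇒4∣ zero _ = 0 , refl
  ι≡0#⇒4∣ (suc zero) ι1≡0 = ⊥-elim (1#≢0# (trans (sym (+-identityʳ 1#)) ι1≡0))
  ι≡0#⇒4∣ (suc (suc zero)) ι2≡0 = ⊥-elim (char≢2 ι2≡0)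
  ι≡0#⇒4∣ (suc (suc (suc zero))) ι3≡0 = ⊥-elim (1#≢0# (trans (sym (+-identityʳ 1#)) (trans (cong (1# +_) (sym ι3≡0)) char4)))
  ι≡0#⇒4∣ (suc (suc (suc (suc d)))) ι[4+d]≡0
    with ι≡0#⇒4∣ d (trans (sym (trans (ι-+ 4 d) (trans (cong (_+ ι d) char4) (+-identityˡ _)))) ι[4+d]≡0)
  ... | k , refl = suc k , sym (ℕ.*-distribˡ-+ 4 1 k)

  -- The trace of R

  frobeniusSum : Car R → Car R
  frobeniusSum y = sumBelow r (λ k → pow y (2 ^ k))

  frobeniusSum-0# : frobeniusSum 0# ≡ 0#
  frobeniusSum-0# = trans (sumBelow-cong r (λ k _ → pow-0#-2^ k)) (sumBelow-0 r)

  π-frobeniusSum : ∀ y → π (frobeniusSum y) ≡ F₂.trace r (π y)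
  π-frobeniusSum y = trans (π-sumBelow r _) (F.sumBelow-cong r (λ k _ → π-pow y (2 ^ k)))

  two*frobeniusSum-π : ∀ x y → π x ≡ π y → two * frobeniusSum x ≡ two * frobeniusSum y
  two*frobeniusSum-π x y πx≡πy = π≡⇒two*≡ _ _ (trans (π-frobeniusSum x) (trans (cong (F₂.trace r) πx≡πy) (sym (π-frobeniusSum y))))

  two*frobeniusSum-+ : ∀ x y → two * frobeniusSum (x + y) ≡ two * frobeniusSum x + two * frobeniusSum y
  two*frobeniusSum-+ x y = trans (π≡⇒two*≡ _ (frobeniusSum x + frobeniusSum y) π-additive) (distribˡ two _ _)
    where
    π-additive : π (frobeniusSum (x + y)) ≡ π (frobeniusSum x + frobeniusSum y)
    π-additive = begin
      π (frobeniusSum (x + y))                     ≡⟨ π-frobeniusSum (x + y) ⟩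
      F₂.trace r (π (x + y))                       ≡⟨ cong (F₂.trace r) (π-+ x y) ⟩
      F₂.trace r (π x F.+ π y)                     ≡⟨ F₂.trace-+ r _ _ ⟩
      F₂.trace r (π x) F.+ F₂.trace r (π y)        ≡⟨ sym (cong₂ F._+_ (π-frobeniusSum x) (π-frobeniusSum y)) ⟩
      π (frobeniusSum x) F.+ π (frobeniusSum y)    ≡⟨ sym (π-+ _ _) ⟩
      π (frobeniusSum x + frobeniusSum y)          ∎

  -- a + a′ = c + 2 √(a a′) with c ∈ 𝒯, for a, a′ ∈ 𝒯.
  module TeichmüllerSum {a a′ : Car R} (a∈𝒯 : IsTeich a) (a′∈𝒯 : IsTeich a′) where

    teichPart carry : Car R
    teichPart = hat (π a F.+ π a′)
    carry = pow a (2 ^ r₀) * pow a′ (2 ^ r₀)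

    private
      √a √a′ : Car R
      √a = pow a (2 ^ r₀)
      √a′ = pow a′ (2 ^ r₀)

      √a² : √a * √a ≡ a
      √a² = trans (sym (pow-2^-suc a r₀)) (teich-pow-q a∈𝒯)

      √a′² : √a′ * √a′ ≡ a′
      √a′² = trans (sym (pow-2^-suc a′ r₀)) (teich-pow-q a′∈𝒯)

      carry² : carry * carry ≡ a * a′
      carry² = trans (solve 2 (λ x y → (x :* y) :* (x :* y) := (x :* x) :* (y :* y)) refl √a √a′) (cong₂ _*_ √a² √a′²)

    teichPart≡a+a′+two*carry : teichPart ≡ a + a′ + two * carry
    teichPart≡a+a′+two*carry with teich-decomposition (√a + √a′)
    ... | φ , √a+√a′≡ε+2φ = trans teichPart≡ε² (sym a+a′+2carry≡ε²)
      where
      ε : Car R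
      ε = hat (π (√a + √a′))
      a+a′+2carry≡ε² : a + a′ + two * carry ≡ ε * ε
      a+a′+2carry≡ε² = begin
        a + a′ + two * carry                     ≡⟨ cong₂ (λ u v → u + v + two * carry) (sym √a²) (sym √a′²) ⟩
        √a * √a + √a′ * √a′ + two * (√a * √a′)   ≡⟨ cong (√a * √a + √a′ * √a′ +_) (sym (x+x≡two*x _)) ⟩
        √a * √a + √a′ * √a′ + (√a * √a′ + √a * √a′) ≡⟨ solve 2 (λ x y → x :* x :+ y :* y :+ (x :* y :+ x :* y) := (x :+ y) :* (x :+ y)) refl √a √a′ ⟩
        (√a + √a′) * (√a + √a′)                  ≡⟨ cong (λ t → t * t) √a+√a′≡ε+2φ ⟩
        (ε + two * φ) * (ε + two * φ)            ≡⟨ square-+two* ε φ ⟩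
        ε * ε                                    ∎
      π[ε²] : π (ε * ε) ≡ π a F.+ π a′
      π[ε²] = begin
        π (ε * ε)                          ≡⟨ cong π (sym a+a′+2carry≡ε²) ⟩
        π (a + a′ + two * carry)           ≡⟨ trans (π-+ _ _) (cong₂ F._+_ (π-+ a a′) (trans (π-* two carry) (trans (cong (F._* π carry) π-two) (F.zeroˡ _)))) ⟩
        π a F.+ π a′ F.+ F.0#              ≡⟨ F.+-identityʳ _ ⟩
        π a F.+ π a′                       ∎
      teichPart≡ε² : teichPart ≡ ε * ε
      teichPart≡ε² = trans (cong hat (sym π[ε²])) (hat-π (teich-* (hat-teich _) (hat-teich _)))

    a+a′≡teichPart+two*carry : a + a′ ≡ teichPart + two * carry
    a+a′≡teichPart+two*carry = begin
      a + a′                                  ≡⟨ sym (trans (cong (a + a′ +_) (two*x+two*x≡0# carry)) (+-identityʳ _)) ⟩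
      a + a′ + (two * carry + two * carry)    ≡⟨ sym (+-assoc _ _ _) ⟩
      a + a′ + two * carry + two * carry      ≡⟨ cong (_+ two * carry) (sym teichPart≡a+a′+two*carry) ⟩
      teichPart + two * carry                 ∎

    pow-teichPart : ∀ n → pow teichPart (2 ^ n) ≡ pow a (2 ^ n) + pow a′ (2 ^ n) + two * pow carry (2 ^ n)
    pow-teichPart zero = trans (*-identityʳ _) (trans teichPart≡a+a′+two*carry
      (sym (cong₂ _+_ (cong₂ _+_ (*-identityʳ a) (*-identityʳ a′)) (cong (two *_) (*-identityʳ carry)))))
    pow-teichPart (suc n) = begin
      pow teichPart (2 ^ suc n)                          ≡⟨ pow-2^-suc teichPart n ⟩
      pow teichPart (2 ^ n) * pow teichPart (2 ^ n)      ≡⟨ cong (λ t → t * t) (pow-teichPart n) ⟩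
      (P + P′ + two * S) * (P + P′ + two * S)            ≡⟨ square-+two* (P + P′) S ⟩
      (P + P′) * (P + P′)                                ≡⟨ solve 2 (λ x y → (x :+ y) :* (x :+ y) := x :* x :+ y :* y :+ (x :* y :+ x :* y)) refl P P′ ⟩
      P * P + P′ * P′ + (P * P′ + P * P′)                ≡⟨ cong (P * P + P′ * P′ +_) (x+x≡two*x _) ⟩
      P * P + P′ * P′ + two * (P * P′)                   ≡⟨ cong (λ t → P * P + P′ * P′ + two * t) PP′≡SS ⟩
      P * P + P′ * P′ + two * (S * S)                    ≡⟨ sym (cong₂ _+_ (cong₂ _+_ (pow-2^-suc a n) (pow-2^-suc a′ n)) (cong (two *_) (pow-2^-suc carry n))) ⟩
      pow a (2 ^ suc n) + pow a′ (2 ^ suc n) + two * pow carry (2 ^ suc n) ∎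
      where
      P P′ S : Car R
      P = pow a (2 ^ n)
      P′ = pow a′ (2 ^ n)
      S = pow carry (2 ^ n)
      PP′≡SS : P * P′ ≡ S * S
      PP′≡SS = trans (sym (pow-distrib-* a a′ (2 ^ n))) (trans (cong (λ t → pow t (2 ^ n)) (sym carry²)) (pow-distrib-* carry carry (2 ^ n)))

    frobeniusSum-teichPart : frobeniusSum teichPart + two * frobeniusSum carry ≡ frobeniusSum a + frobeniusSum a′
    frobeniusSum-teichPart = begin
      frobeniusSum teichPart + two * Sc                                    ≡⟨ cong (_+ two * Sc) (sumBelow-cong r (λ k _ → pow-teichPart k)) ⟩
      sumBelow r (λ k → pow a (2 ^ k) + pow a′ (2 ^ k) + two * pow carry (2 ^ k)) + two * Sc
                                                                           ≡⟨ cong (_+ two * Sc) (trans (sumBelow-+ r _ _) (cong₂ _+_ (sumBelow-+ r _ _) (sumBelow-*ˡ r two _))) ⟩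
      frobeniusSum a + frobeniusSum a′ + two * Sc + two * Sc               ≡⟨ +-assoc _ _ _ ⟩
      frobeniusSum a + frobeniusSum a′ + (two * Sc + two * Sc)             ≡⟨ cong (frobeniusSum a + frobeniusSum a′ +_) (two*x+two*x≡0# Sc) ⟩
      frobeniusSum a + frobeniusSum a′ + 0#                                ≡⟨ +-identityʳ _ ⟩
      frobeniusSum a + frobeniusSum a′                                     ∎
      where
      Sc : Car R
      Sc = frobeniusSum carry

  module Trace (Tr : Car R → Fin 4) (isTrace : IsGRTrace r R C Tr) where

    trᴿ : Car R → Car R
    trᴿ x = ι (toℕ (Tr x))

    trᴿ-decomposition : ∀ {a} b x → IsTeich a → x ≡ a + two * b → trᴿ x ≡ frobeniusSum a + two * frobeniusSum b
    trᴿ-decomposition {a} b x a∈𝒯 x≡a+2b = begin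
      trᴿ x                                    ≡⟨ cong trᴿ (trans x≡a+2b (cong (a +_) 2b≡2b̂)) ⟩
      trᴿ (a + two * b̂)                        ≡⟨ isTrace a b̂ a∈𝒯 (hat-teich (π b)) ⟩
      sumFin r (λ i → pow a (2 ^ toℕ i) + two * pow b̂ (2 ^ toℕ i))
                                               ≡⟨ sumFin≗sumBelow r (λ k → pow a (2 ^ k) + two * pow b̂ (2 ^ k)) ⟩
      sumBelow r (λ k → pow a (2 ^ k) + two * pow b̂ (2 ^ k))
                                               ≡⟨ trans (sumBelow-+ r _ _) (cong (frobeniusSum a +_) (sumBelow-*ˡ r two _)) ⟩
      frobeniusSum a + two * frobeniusSum b̂    ≡⟨ cong (frobeniusSum a +_) (two*frobeniusSum-π b̂ b (π-hat (π b))) ⟩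
      frobeniusSum a + two * frobeniusSum b    ∎
      where
      b̂ : Car R
      b̂ = hat (π b)
      2b≡2b̂ : two * b ≡ two * b̂
      2b≡2b̂ = π≡⇒two*≡ b b̂ (sym (π-hat (π b)))

    trᴿ-+ : ∀ x y → trᴿ (x + y) ≡ trᴿ x + trᴿ y
    trᴿ-+ x y with teich-decomposition x | teich-decomposition y
    ... | b , x≡a+2b | b′ , y≡a′+2b′ = begin
      trᴿ (x + y)                                        ≡⟨ trᴿ-decomposition (carry + (b + b′)) (x + y) (hat-teich _) x+y≡ ⟩
      S teichPart + two * S (carry + (b + b′))           ≡⟨ cong (S teichPart +_) (trans (two*frobeniusSum-+ carry _) (cong (two * S carry +_) (two*frobeniusSum-+ b b′))) ⟩
      S teichPart + (two * S carry + (two * S b + two * S b′)) ≡⟨ sym (+-assoc _ _ _) ⟩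
      S teichPart + two * S carry + (two * S b + two * S b′)   ≡⟨ cong (_+ (two * S b + two * S b′)) frobeniusSum-teichPart ⟩
      S a + S a′ + (two * S b + two * S b′)              ≡⟨ solve 4 (λ p p′ t t′ → p :+ p′ :+ (t :+ t′) := (p :+ t) :+ (p′ :+ t′)) refl _ _ _ _ ⟩
      (S a + two * S b) + (S a′ + two * S b′)            ≡⟨ sym (cong₂ _+_ (trᴿ-decomposition b x (hat-teich _) x≡a+2b) (trᴿ-decomposition b′ y (hat-teich _) y≡a′+2b′)) ⟩
      trᴿ x + trᴿ y                                      ∎
      where
      S : Car R → Car R
      S = frobeniusSum
      a a′ : Car R
      a = hat (π x)
      a′ = hat (π y)
      open TeichmüllerSum (hat-teich (π x)) (hat-teich (π y))
      x+y≡ : x + y ≡ teichPart + two * (carry + (b + b′))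
      x+y≡ = begin
        x + y                                  ≡⟨ cong₂ _+_ x≡a+2b y≡a′+2b′ ⟩
        a + two * b + (a′ + two * b′)          ≡⟨ solve 5 (λ a b a′ b′ t → a :+ t :* b :+ (a′ :+ t :* b′) := (a :+ a′) :+ t :* (b :+ b′)) refl a b a′ b′ two ⟩
        a + a′ + two * (b + b′)                ≡⟨ cong (_+ two * (b + b′)) a+a′≡teichPart+two*carry ⟩
        teichPart + two * carry + two * (b + b′) ≡⟨ trans (+-assoc _ _ _) (cong (teichPart +_) (sym (distribˡ two carry _))) ⟩
        teichPart + two * (carry + (b + b′))   ∎

    trᴿ-teich : ∀ {t} → IsTeich t → trᴿ t ≡ frobeniusSum t
    trᴿ-teich {t} t∈𝒯 = begin
      trᴿ t                                  ≡⟨ trᴿ-decomposition 0# t t∈𝒯 (sym (trans (cong (t +_) (zeroʳ two)) (+-identityʳ t))) ⟩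
      frobeniusSum t + two * frobeniusSum 0# ≡⟨ cong (λ u → frobeniusSum t + two * u) frobeniusSum-0# ⟩
      frobeniusSum t + two * 0#              ≡⟨ trans (cong (frobeniusSum t +_) (zeroʳ two)) (+-identityʳ _) ⟩
      frobeniusSum t                         ∎

    trᴿ-0# : trᴿ 0# ≡ 0#
    trᴿ-0# = trans (trᴿ-teich teich-0#) frobeniusSum-0#

    trᴿ-two* : ∀ y → trᴿ (two * y) ≡ two * frobeniusSum y
    trᴿ-two* y = trans (trᴿ-decomposition y (two * y) teich-0# (sym (+-identityˡ _)))
                   (trans (cong (_+ two * frobeniusSum y) frobeniusSum-0#) (+-identityˡ _))

    two*trᴿ : ∀ x → two * trᴿ x ≡ two * frobeniusSum x
    two*trᴿ x with teich-decomposition x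
    ... | b , x≡a+2b = begin
      two * trᴿ x                                        ≡⟨ cong (two *_) (trᴿ-decomposition b x (hat-teich _) x≡a+2b) ⟩
      two * (frobeniusSum a + two * frobeniusSum b)      ≡⟨ distribˡ two _ _ ⟩
      two * frobeniusSum a + two * (two * frobeniusSum b) ≡⟨ cong (two * frobeniusSum a +_) (two*[two*x]≡0# _) ⟩
      two * frobeniusSum a + 0#                          ≡⟨ +-identityʳ _ ⟩
      two * frobeniusSum a                               ≡⟨ two*frobeniusSum-π a x (π-hat (π x)) ⟩
      two * frobeniusSum x                               ∎
      where
      a : Car R
      a = hat (π x)

    trᴿ-sumBelow : ∀ n f → trᴿ (sumBelow n f) ≡ sumBelow n (λ i → trᴿ (f i))
    trᴿ-sumBelow zero f = trᴿ-0#
    trᴿ-sumBelow (suc n) f = trans (trᴿ-+ _ _) (cong (_+ trᴿ (f n)) (trᴿ-sumBelow n f))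

module FrobeniusTwistedSums (K : FinCommRing) (r : ℕ) where

  open FinCommRingProperties K
  open ≡-Reasoning

  FrobeniusPeriodic : Carrier → Set
  FrobeniusPeriodic x = ∀ n → pow x (2 ^ (n ℕ.+ r)) ≡ pow x (2 ^ n)

  twisted : Carrier → Carrier → Carrier → Carrier → ℕ → ℕ → ℕ → Carrier
  twisted c x y z i j k = pow c (2 ^ k) * pow x (2 ^ k) * pow y (2 ^ (i ℕ.+ k)) * pow z (2 ^ (j ℕ.+ k))

  pow-monomial : ∀ c x y z i j k → pow (x * (c * pow y (2 ^ i) * pow z (2 ^ j))) (2 ^ k) ≡ twisted c x y z i j k
  pow-monomial c x y z i j k = begin
    pow (x * (c * pow y (2 ^ i) * pow z (2 ^ j))) (2 ^ k)
      ≡⟨ trans (pow-distrib-* x _ (2 ^ k)) (cong (pow x (2 ^ k) *_) (trans (pow-distrib-* _ _ (2 ^ k)) (cong (_* _) (pow-distrib-* c _ (2 ^ k))))) ⟩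
    pow x (2 ^ k) * (pow c (2 ^ k) * pow (pow y (2 ^ i)) (2 ^ k) * pow (pow z (2 ^ j)) (2 ^ k))
      ≡⟨ cong₂ (λ s t → pow x (2 ^ k) * (pow c (2 ^ k) * s * t)) (sym (pow-2^-+ y i k)) (sym (pow-2^-+ z j k)) ⟩
    pow x (2 ^ k) * (pow c (2 ^ k) * pow y (2 ^ (i ℕ.+ k)) * pow z (2 ^ (j ℕ.+ k)))
      ≡⟨ solve 4 (λ x c y z → x :* (c :* y :* z) := c :* x :* y :* z) refl _ _ _ _ ⟩
    twisted c x y z i j k ∎

  tripleSum : (ℕ → ℕ → Carrier) → Carrier → Carrier → Carrier → Carrier
  tripleSum c x y z = sumBelow r (λ i → sumBelow r (λ j → sumBelow r (λ k → twisted (c i j) x y z i j k)))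

  twisted-reindex : ∀ {c c′ x y z} i j k → i ℕ.< r → pow c′ (2 ^ i) ≡ c → FrobeniusPeriodic x → FrobeniusPeriodic z →
    twisted c x y z i j k ≡ twisted c′ y x z (r ∸ i) (j ℕ.+ (r ∸ i)) (k ℕ.+ i)
  twisted-reindex {c} {c′} {x} {y} {z} i j k i<r c′^2^i≡c x-frob z-frob = begin
    pow c (2 ^ k) * pow x (2 ^ k) * pow y (2 ^ (i ℕ.+ k)) * pow z (2 ^ (j ℕ.+ k))
      ≡⟨ cong₂ (λ s t → s * pow x (2 ^ k) * pow y (2 ^ (i ℕ.+ k)) * t) c-exponent z-exponent ⟩
    pow c′ (2 ^ (k ℕ.+ i)) * pow x (2 ^ k) * pow y (2 ^ (i ℕ.+ k)) * pow z (2 ^ (j ℕ.+ (r ∸ i) ℕ.+ (k ℕ.+ i)))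
      ≡⟨ cong₂ (λ s t → pow c′ (2 ^ (k ℕ.+ i)) * s * t * pow z (2 ^ (j ℕ.+ (r ∸ i) ℕ.+ (k ℕ.+ i)))) x-exponent (cong (λ e → pow y (2 ^ e)) (ℕ.+-comm i k)) ⟩
    pow c′ (2 ^ (k ℕ.+ i)) * pow x (2 ^ ((r ∸ i) ℕ.+ (k ℕ.+ i))) * pow y (2 ^ (k ℕ.+ i)) * pow z (2 ^ (j ℕ.+ (r ∸ i) ℕ.+ (k ℕ.+ i)))
      ≡⟨ solve 4 (λ h a b c → h :* a :* b :* c := h :* b :* a :* c) refl _ _ _ _ ⟩
    twisted c′ y x z (r ∸ i) (j ℕ.+ (r ∸ i)) (k ℕ.+ i) ∎
    where
    [r∸i]+[k+i]≡k+r : (r ∸ i) ℕ.+ (k ℕ.+ i) ≡ k ℕ.+ r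
    [r∸i]+[k+i]≡k+r = trans (ℕ.+-comm (r ∸ i) (k ℕ.+ i)) (trans (ℕ.+-assoc k i _) (cong (k ℕ.+_) (ℕ.m+[n∸m]≡n (ℕ.<⇒≤ i<r))))
    c-exponent : pow c (2 ^ k) ≡ pow c′ (2 ^ (k ℕ.+ i))
    c-exponent = trans (cong (λ t → pow t (2 ^ k)) (sym c′^2^i≡c))
                   (trans (sym (pow-2^-+ c′ i k)) (cong (λ e → pow c′ (2 ^ e)) (ℕ.+-comm i k)))
    x-exponent : pow x (2 ^ k) ≡ pow x (2 ^ ((r ∸ i) ℕ.+ (k ℕ.+ i)))
    x-exponent = sym (trans (cong (λ e → pow x (2 ^ e)) [r∸i]+[k+i]≡k+r) (x-frob k))
    z-exponent : pow z (2 ^ (j ℕ.+ k)) ≡ pow z (2 ^ (j ℕ.+ (r ∸ i) ℕ.+ (k ℕ.+ i)))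
    z-exponent = sym (trans (cong (λ e → pow z (2 ^ e)) (trans (ℕ.+-assoc j _ _) (trans (cong (j ℕ.+_) [r∸i]+[k+i]≡k+r) (sym (ℕ.+-assoc j k r)))))
                   (z-frob (j ℕ.+ k)))

  -- Under the coefficient symmetry c_{ij} = c_{r-i, j+r-i}^(2^i) the substitution
  -- (i, j, k) ↦ (r - i, j + r - i, k + i) exchanges the roles of x and y.
  tripleSum-swap : (c : ℕ → ℕ → Carrier) →
    (∀ i j → c (i ℕ.+ r) j ≡ c i j) → (∀ i j → c i (j ℕ.+ r) ≡ c i j) → (∀ i j → FrobeniusPeriodic (c i j)) →
    (∀ i j → i ℕ.< r → j ℕ.< r → pow (c (r ∸ i) (j ℕ.+ (r ∸ i))) (2 ^ i) ≡ c i j) →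
    ∀ {x y z} → FrobeniusPeriodic x → FrobeniusPeriodic y → FrobeniusPeriodic z →
    tripleSum c x y z ≡ tripleSum c y x z
  tripleSum-swap c c-periodicˡ c-periodicʳ c-frob c-symmetric {x} {y} {z} x-frob y-frob z-frob = begin
    tripleSum c x y z
      ≡⟨ sumBelow-cong r (λ i i<r → sumBelow-cong r (λ j j<r → sumBelow-cong r (λ k _ → twisted-reindex i j k i<r (c-symmetric i j i<r j<r) x-frob z-frob))) ⟩
    sumBelow r (λ i → sumBelow r (λ j → sumBelow r (λ k → T (r ∸ i) (j ℕ.+ (r ∸ i)) (k ℕ.+ i))))
      ≡⟨ sumBelow-cong r (λ i _ → sumBelow-cong r (λ j _ → sumBelow-shift r i (T (r ∸ i) (j ℕ.+ (r ∸ i))) (T-periodicᵏ _ _))) ⟩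
    sumBelow r (λ i → sumBelow r (λ j → sumBelow r (λ k → T (r ∸ i) (j ℕ.+ (r ∸ i)) k)))
      ≡⟨ sumBelow-cong r (λ i _ → sumBelow-shift r (r ∸ i) (λ j → sumBelow r (T (r ∸ i) j)) (λ j → sumBelow-cong r (λ k _ → T-periodicʲ _ j k))) ⟩
    sumBelow r (λ i → sumBelow r (λ j → sumBelow r (λ k → T (r ∸ i) j k)))
      ≡⟨ sumBelow-reflect r (λ i → sumBelow r (λ j → sumBelow r (T i j))) (λ i → sumBelow-cong r (λ j _ → sumBelow-cong r (λ k _ → T-periodicⁱ i j k))) ⟩
    tripleSum c y x z ∎
    where
    T : ℕ → ℕ → ℕ → Carrier
    T i j k = twisted (c i j) y x z i j k
    T-periodicᵏ : ∀ i j → Periodic r (T i j)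
    T-periodicᵏ i j k = trans
      (cong₂ (λ s t → s * t * pow x (2 ^ (i ℕ.+ (k ℕ.+ r))) * pow z (2 ^ (j ℕ.+ (k ℕ.+ r)))) (c-frob i j k) (y-frob k))
      (cong₂ (λ s t → pow (c i j) (2 ^ k) * pow y (2 ^ k) * s * t)
        (trans (cong (λ e → pow x (2 ^ e)) (sym (ℕ.+-assoc i k r))) (x-frob (i ℕ.+ k)))
        (trans (cong (λ e → pow z (2 ^ e)) (sym (ℕ.+-assoc j k r))) (z-frob (j ℕ.+ k))))
    T-periodicʲ : ∀ i j k → T i (j ℕ.+ r) k ≡ T i j k
    T-periodicʲ i j k = cong₂ (λ s t → pow s (2 ^ k) * pow y (2 ^ k) * pow x (2 ^ (i ℕ.+ k)) * t) (c-periodicʳ i j)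
                          (trans (cong (λ e → pow z (2 ^ e)) (ℕ+.xy∙z≈xz∙y j r k)) (z-frob (j ℕ.+ k)))
    T-periodicⁱ : ∀ i j k → T (i ℕ.+ r) j k ≡ T i j k
    T-periodicⁱ i j k = cong₂ (λ s t → pow s (2 ^ k) * pow y (2 ^ k) * t * pow z (2 ^ (j ℕ.+ k))) (c-periodicˡ i j)
                          (trans (cong (λ e → pow x (2 ^ e)) (ℕ+.xy∙z≈xz∙y i r k)) (x-frob (i ℕ.+ k)))

module LinearizedSums (K : FinCommRing) (r₀ : ℕ) where

  open FinCommRingProperties K

  r : ℕ
  r = suc r₀

  mod-periodic : ∀ i → (i ℕ.+ r) DM.mod r ≡ i DM.mod r
  mod-periodic i = Fin.toℕ-injective (trans (Fin.toℕ-fromℕ< _) (trans (DM.[m+n]%n≡m%n i r) (sym (Fin.toℕ-fromℕ< _))))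

  linearized≡sumBelow : ∀ (c : Fin r → Fin r → Carrier) x y → linearized K r c x y ≡
    sumBelow r (λ i → sumBelow r (λ j → c (i DM.mod r) (j DM.mod r) * pow x (2 ^ i) * pow y (2 ^ j)))
  linearized≡sumBelow c x y = trans
    (sumFin-cong (λ i → trans (sumFin-cong (λ j → cong₂ (λ s t → c s t * pow x (2 ^ toℕ i) * pow y (2 ^ toℕ j)) (sym (toℕ-mod i)) (sym (toℕ-mod j))))
                          (sumFin≗sumBelow r (λ j → c (toℕ i DM.mod r) (j DM.mod r) * pow x (2 ^ toℕ i) * pow y (2 ^ j)))))
    (sumFin≗sumBelow r (λ i → sumBelow r (λ j → c (i DM.mod r) (j DM.mod r) * pow x (2 ^ i) * pow y (2 ^ j))))
    where
    toℕ-mod : ∀ (i : Fin r) → toℕ i DM.mod r ≡ i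
    toℕ-mod i = Fin.toℕ-injective (trans (Fin.toℕ-fromℕ< _) (DM.m<n⇒m%n≡m (Fin.toℕ<n i)))
    sumFin-cong : {f g : Fin r → Carrier} → (∀ i → f i ≡ g i) → sumFin r f ≡ sumFin r g
    sumFin-cong = sumOver-cong (allFin r)

module SymplecticPresemifield
  (r₀ : ℕ) (F R : FinCommRing) (isField : IsFieldOfOrder F (2 ^ suc r₀))
  (π : Car R → Car F) (isGaloisRing : IsGaloisRing4 (suc r₀) F R π)
  (C : CyclicGen (suc r₀) R) (hat : Car F → Car R) (isTeichLift : IsTeichLift F R π C hat)
  (Tr : Car R → Fin 4) (isTrace : IsGRTrace (suc r₀) R C Tr)
  (_∘_ : Car F → Car F → Car F) (isSymplectic : IsSymplecticPresemifield (suc r₀) F _∘_)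
  (a : Fin (suc r₀) → Fin (suc r₀) → Car F) (∘-linearized : ∀ x y → x ∘ y ≡ linearized F (suc r₀) a x y) where

  open GaloisRing r₀ F R π isGaloisRing C hat isTeichLift public
  open Trace Tr isTrace public
  open FinCommRingProperties R
  open ≡-Reasoning

  private
    module 𝔽 = FiniteFieldOfCharacteristicTwo F isField F-two≡0#
    module Fᶠ = FrobeniusTwistedSums F r
    module Rᶠ = FrobeniusTwistedSums R r
    open 𝔽.FrobeniusIndependence r (π (CyclicGen.g C)) generator-separating

  tr : Car F → Car F
  tr = F₂.trace r

  private
    m+n+[r∸n]≡m+r : ∀ m n → n ℕ.≤ r → m ℕ.+ n ℕ.+ (r ∸ n) ≡ m ℕ.+ r
    m+n+[r∸n]≡m+r m n n≤r = trans (ℕ.+-assoc m n _) (cong (m ℕ.+_) (ℕ.m+[n∸m]≡n n≤r))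

  A : ℕ → ℕ → Car F
  A i j = a (i DM.mod r) (j DM.mod r)

  A-periodicˡ : ∀ i j → A (i ℕ.+ r) j ≡ A i j
  A-periodicˡ i j = cong (λ t → a t (j DM.mod r)) (LinearizedSums.mod-periodic F r₀ i)

  A-periodicʳ : ∀ i j → A i (j ℕ.+ r) ≡ A i j
  A-periodicʳ i j = cong (a (i DM.mod r)) (LinearizedSums.mod-periodic F r₀ j)

  F-frobeniusPeriodic : ∀ x → Fᶠ.FrobeniusPeriodic x
  F-frobeniusPeriodic x n = trans (F.pow-2^-+ x n r) (F-pow-q _)

  ∘-expansion : ∀ x y → x ∘ y ≡ F.sumBelow r (λ i → F.sumBelow r (λ j → A i j F.* F.pow x (2 ^ i) F.* F.pow y (2 ^ j)))
  ∘-expansion x y = trans (∘-linearized x y) (LinearizedSums.linearized≡sumBelow F r₀ a x y)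

  trace-symmetric : ∀ w u m → tr (w F.* (u ∘ m)) ≡ tr ((w ∘ m) F.* u)
  trace-symmetric w u m = F.x∙y⁻¹≈ε⇒x≈y (tr X) (tr Y) (begin
    tr X F.+ F.- tr Y            ≡⟨ cong (tr X F.+_) (F₂.-x≡x (tr Y)) ⟩
    tr X F.+ tr Y                ≡⟨ cong (λ t → tr X F.+ tr t) (sym (F₂.-x≡x Y)) ⟩
    tr X F.+ tr (F.- Y)          ≡⟨ sym (F₂.trace-+ r X (F.- Y)) ⟩
    tr (X F.+ F.- Y)             ≡⟨ sym (F₂.absTr≡trace r _) ⟩
    absTr F r (X F.+ F.- Y)      ≡⟨ IsSymplecticPresemifield.isotropic-graph isSymplectic m w u ⟩
    F.0#                         ∎)
    where
    X Y : Car F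
    X = w F.* (u ∘ m)
    Y = (w ∘ m) F.* u

  trace-expansion : ∀ w u m → tr (w F.* (u ∘ m)) ≡ Fᶠ.tripleSum A w u m
  trace-expansion w u m = begin
    tr (w F.* (u ∘ m))                                            ≡⟨ cong (λ t → tr (w F.* t)) (∘-expansion u m) ⟩
    tr (w F.* F.sumBelow r (λ i → F.sumBelow r (T i)))            ≡⟨ cong tr (sym (trans (F.sumBelow-cong r (λ i _ → F.sumBelow-*ˡ r w (T i))) (F.sumBelow-*ˡ r w _))) ⟩
    tr (F.sumBelow r (λ i → F.sumBelow r (λ j → w F.* T i j)))    ≡⟨ trans (F₂.trace-sumBelow r r _) (F.sumBelow-cong r (λ i _ → F₂.trace-sumBelow r r _)) ⟩
    F.sumBelow r (λ i → F.sumBelow r (λ j → tr (w F.* T i j)))    ≡⟨ F.sumBelow-cong r (λ i _ → F.sumBelow-cong r (λ j _ → F.sumBelow-cong r (λ k _ → Fᶠ.pow-monomial (A i j) w u m i j k))) ⟩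
    Fᶠ.tripleSum A w u m                                          ∎
    where
    T : ℕ → ℕ → Car F
    T i j = A i j F.* F.pow u (2 ^ i) F.* F.pow m (2 ^ j)

  -- Reading off the coefficient of u in  tr (w (u ∘ m)) = tr ((w ∘ m) u).
  ∘-adjoint-expansion : ∀ w m →
    F.sumBelow r (λ k → F.sumBelow r (λ j → F.pow (A (r ∸ k) j) (2 ^ k) F.* F.pow w (2 ^ k) F.* F.pow m (2 ^ (j ℕ.+ k)))) ≡ w ∘ m
  ∘-adjoint-expansion w m =
    trans (frobenius-coefficients-unique (λ b → F.sumBelow r (λ k → Z k b)) (λ b → F.pow (w ∘ m) (2 ^ b)) same-form 0 (ℕ.s≤s ℕ.z≤n))
          (F.*-identityʳ _)
    where
    Z : ℕ → ℕ → Car F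
    Z k b = F.sumBelow r (λ j → F.pow (A (b ℕ.+ (r ∸ k)) j) (2 ^ k) F.* F.pow w (2 ^ k) F.* F.pow m (2 ^ (j ℕ.+ k)))
    Zu : Car F → ℕ → ℕ → Car F
    Zu u k b = F.sumBelow r (λ j → F.pow (A (b ℕ.+ (r ∸ k)) j) (2 ^ k) F.* F.pow w (2 ^ k) F.* F.pow u (2 ^ b) F.* F.pow m (2 ^ (j ℕ.+ k)))
    Zu-periodic : ∀ u k → F.Periodic r (Zu u k)
    Zu-periodic u k b = F.sumBelow-cong r (λ j _ → cong₂ (λ s t → F.pow s (2 ^ k) F.* F.pow w (2 ^ k) F.* t F.* F.pow m (2 ^ (j ℕ.+ k)))
      (trans (cong (λ t → A t j) (ℕ+.xy∙z≈xz∙y b r (r ∸ k))) (A-periodicˡ (b ℕ.+ (r ∸ k)) j)) (F-frobeniusPeriodic u b))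
    Zu≡ : ∀ u k b → Zu u k b ≡ Z k b F.* F.pow u (2 ^ b)
    Zu≡ u k b = trans (F.sumBelow-cong r (λ j _ → F.solve 4 (λ c w u m → c F.:* w F.:* u F.:* m F.:= c F.:* w F.:* m F.:* u) refl _ _ _ _))
                      (F.sumBelow-*ʳ r _ _)
    same-form : ∀ u → F.sumBelow r (λ b → F.sumBelow r (λ k → Z k b) F.* F.pow u (2 ^ b))
                    ≡ F.sumBelow r (λ b → F.pow (w ∘ m) (2 ^ b) F.* F.pow u (2 ^ b))
    same-form u = begin
      F.sumBelow r (λ b → F.sumBelow r (λ k → Z k b) F.* F.pow u (2 ^ b))
        ≡⟨ F.sumBelow-cong r (λ b _ → trans (sym (F.sumBelow-*ʳ r _ _)) (F.sumBelow-cong r (λ k _ → sym (Zu≡ u k b)))) ⟩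
      F.sumBelow r (λ b → F.sumBelow r (λ k → Zu u k b))
        ≡⟨ F.sumBelow-swap r r _ ⟩
      F.sumBelow r (λ k → F.sumBelow r (λ b → Zu u k b))
        ≡⟨ F.sumBelow-cong r (λ k _ → sym (F.sumBelow-shift r k (Zu u k) (Zu-periodic u k))) ⟩
      F.sumBelow r (λ k → F.sumBelow r (λ i → Zu u k (i ℕ.+ k)))
        ≡⟨ F.sumBelow-cong r (λ k k<r → F.sumBelow-cong r (λ i _ → F.sumBelow-cong r (λ j _ →
             cong (λ t → F.pow t (2 ^ k) F.* F.pow w (2 ^ k) F.* F.pow u (2 ^ (i ℕ.+ k)) F.* F.pow m (2 ^ (j ℕ.+ k)))
                  (trans (cong (λ t → A t j) (m+n+[r∸n]≡m+r i k (ℕ.<⇒≤ k<r))) (A-periodicˡ i j))))) ⟩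
      F.sumBelow r (λ k → F.sumBelow r (λ i → F.sumBelow r (λ j → Fᶠ.twisted (A i j) w u m i j k)))
        ≡⟨ trans (sym (F.sumBelow-swap r r _)) (F.sumBelow-cong r (λ i _ → sym (F.sumBelow-swap r r _))) ⟩
      Fᶠ.tripleSum A w u m
        ≡⟨ sym (trace-expansion w u m) ⟩
      tr (w F.* (u ∘ m))
        ≡⟨ trace-symmetric w u m ⟩
      tr ((w ∘ m) F.* u)
        ≡⟨ F.sumBelow-cong r (λ k _ → F.pow-distrib-* _ _ (2 ^ k)) ⟩
      F.sumBelow r (λ b → F.pow (w ∘ m) (2 ^ b) F.* F.pow u (2 ^ b)) ∎

  -- Comparing coefficients of w in the two expansions of w ∘ m.
  ∘-coefficient-of-w : ∀ m i → i ℕ.< r →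
    F.sumBelow r (λ j → F.pow (A (r ∸ i) j) (2 ^ i) F.* F.pow m (2 ^ (j ℕ.+ i))) ≡ F.sumBelow r (λ j → A i j F.* F.pow m (2 ^ j))
  ∘-coefficient-of-w m = frobenius-coefficients-unique
    (λ k → F.sumBelow r (λ j → F.pow (A (r ∸ k) j) (2 ^ k) F.* F.pow m (2 ^ (j ℕ.+ k))))
    (λ i → F.sumBelow r (λ j → A i j F.* F.pow m (2 ^ j))) same-form
    where
    same-form : ∀ w → F.sumBelow r (λ k → F.sumBelow r (λ j → F.pow (A (r ∸ k) j) (2 ^ k) F.* F.pow m (2 ^ (j ℕ.+ k))) F.* F.pow w (2 ^ k))
                    ≡ F.sumBelow r (λ i → F.sumBelow r (λ j → A i j F.* F.pow m (2 ^ j)) F.* F.pow w (2 ^ i))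
    same-form w = begin
      F.sumBelow r (λ k → F.sumBelow r (λ j → F.pow (A (r ∸ k) j) (2 ^ k) F.* F.pow m (2 ^ (j ℕ.+ k))) F.* F.pow w (2 ^ k))
        ≡⟨ F.sumBelow-cong r (λ k _ → trans (sym (F.sumBelow-*ʳ r _ _)) (F.sumBelow-cong r (λ j _ → F.solve 3 (λ c m w → c F.:* m F.:* w F.:= c F.:* w F.:* m) refl _ _ _))) ⟩
      F.sumBelow r (λ k → F.sumBelow r (λ j → F.pow (A (r ∸ k) j) (2 ^ k) F.* F.pow w (2 ^ k) F.* F.pow m (2 ^ (j ℕ.+ k))))
        ≡⟨ ∘-adjoint-expansion w m ⟩
      w ∘ m
        ≡⟨ ∘-expansion w m ⟩
      F.sumBelow r (λ i → F.sumBelow r (λ j → A i j F.* F.pow w (2 ^ i) F.* F.pow m (2 ^ j)))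
        ≡⟨ F.sumBelow-cong r (λ i _ → trans (F.sumBelow-cong r (λ j _ → F.solve 3 (λ c w m → c F.:* w F.:* m F.:= c F.:* m F.:* w) refl _ _ _)) (F.sumBelow-*ʳ r _ _)) ⟩
      F.sumBelow r (λ i → F.sumBelow r (λ j → A i j F.* F.pow m (2 ^ j)) F.* F.pow w (2 ^ i)) ∎

  coefficient-symmetry : ∀ i j → i ℕ.< r → j ℕ.< r → F.pow (A (r ∸ i) (j ℕ.+ (r ∸ i))) (2 ^ i) ≡ A i j
  coefficient-symmetry i j i<r = frobenius-coefficients-unique (λ j → F.pow (A (r ∸ i) (j ℕ.+ (r ∸ i))) (2 ^ i)) (A i) same-form j
    where
    h : Car F → ℕ → Car F
    h m j = F.pow (A (r ∸ i) (j ℕ.+ (r ∸ i))) (2 ^ i) F.* F.pow m (2 ^ j)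
    h-periodic : ∀ m → F.Periodic r (h m)
    h-periodic m j = cong₂ (λ s t → F.pow s (2 ^ i) F.* t)
      (trans (cong (A (r ∸ i)) (ℕ+.xy∙z≈xz∙y j r (r ∸ i))) (A-periodicʳ (r ∸ i) (j ℕ.+ (r ∸ i)))) (F-frobeniusPeriodic m j)
    same-form : ∀ m → F.sumBelow r (h m) ≡ F.sumBelow r (λ j → A i j F.* F.pow m (2 ^ j))
    same-form m = begin
      F.sumBelow r (h m)                          ≡⟨ sym (F.sumBelow-shift r i (h m) (h-periodic m)) ⟩
      F.sumBelow r (λ j → h m (j ℕ.+ i))          ≡⟨ F.sumBelow-cong r (λ j _ → cong (λ t → F.pow t (2 ^ i) F.* F.pow m (2 ^ (j ℕ.+ i)))
                                                       (trans (cong (A (r ∸ i)) (m+n+[r∸n]≡m+r j i (ℕ.<⇒≤ i<r))) (A-periodicʳ (r ∸ i) j))) ⟩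
      F.sumBelow r (λ j → F.pow (A (r ∸ i) j) (2 ^ i) F.* F.pow m (2 ^ (j ℕ.+ i)))
                                                  ≡⟨ ∘-coefficient-of-w m i i<r ⟩
      F.sumBelow r (λ j → A i j F.* F.pow m (2 ^ j)) ∎

  Â : ℕ → ℕ → Car R
  Â i j = hat (A i j)

  _∘ᴿ_ : Car R → Car R → Car R
  _∘ᴿ_ = linearized R r (λ i j → hat (a i j))

  ∘ᴿ-expansion : ∀ x y → x ∘ᴿ y ≡ sumBelow r (λ i → sumBelow r (λ j → Â i j * pow x (2 ^ i) * pow y (2 ^ j)))
  ∘ᴿ-expansion = LinearizedSums.linearized≡sumBelow R r₀ (λ i j → hat (a i j))

  π-∘ᴿ : ∀ x m → π (x ∘ᴿ hat m) ≡ π x ∘ m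
  π-∘ᴿ x m = begin
    π (x ∘ᴿ hat m)                                                                      ≡⟨ cong π (∘ᴿ-expansion x (hat m)) ⟩
    π (sumBelow r (λ i → sumBelow r (λ j → Â i j * pow x (2 ^ i) * pow (hat m) (2 ^ j)))) ≡⟨ trans (π-sumBelow r _) (F.sumBelow-cong r (λ i _ → π-sumBelow r _)) ⟩
    F.sumBelow r (λ i → F.sumBelow r (λ j → π (Â i j * pow x (2 ^ i) * pow (hat m) (2 ^ j))))
                                                                                        ≡⟨ F.sumBelow-cong r (λ i _ → F.sumBelow-cong r (λ j _ → π-term i j)) ⟩
    F.sumBelow r (λ i → F.sumBelow r (λ j → A i j F.* F.pow (π x) (2 ^ i) F.* F.pow m (2 ^ j)))
                                                                                        ≡⟨ sym (∘-expansion (π x) m) ⟩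
    π x ∘ m                                                                             ∎
    where
    π-term : ∀ i j → π (Â i j * pow x (2 ^ i) * pow (hat m) (2 ^ j)) ≡ A i j F.* F.pow (π x) (2 ^ i) F.* F.pow m (2 ^ j)
    π-term i j = trans (π-* _ _) (cong₂ F._*_ (trans (π-* _ _) (cong₂ F._*_ (π-hat _) (π-pow x (2 ^ i))))
                                              (trans (π-pow _ (2 ^ j)) (cong (λ t → F.pow t (2 ^ j)) (π-hat m))))

  trᴿ-∘ᴿ-expansion : ∀ {x y z} → IsTeich x → IsTeich y → IsTeich z → trᴿ (x * (y ∘ᴿ z)) ≡ Rᶠ.tripleSum Â x y z
  trᴿ-∘ᴿ-expansion {x} {y} {z} x∈𝒯 y∈𝒯 z∈𝒯 = begin
    trᴿ (x * (y ∘ᴿ z))                                                ≡⟨ cong (λ t → trᴿ (x * t)) (∘ᴿ-expansion y z) ⟩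
    trᴿ (x * sumBelow r (λ i → sumBelow r (T i)))                     ≡⟨ cong trᴿ (sym (trans (sumBelow-cong r (λ i _ → sumBelow-*ˡ r x (T i))) (sumBelow-*ˡ r x _))) ⟩
    trᴿ (sumBelow r (λ i → sumBelow r (λ j → x * T i j)))             ≡⟨ trans (trᴿ-sumBelow r _) (sumBelow-cong r (λ i _ → trᴿ-sumBelow r _)) ⟩
    sumBelow r (λ i → sumBelow r (λ j → trᴿ (x * T i j)))             ≡⟨ sumBelow-cong r (λ i _ → sumBelow-cong r (λ j _ → trᴿ-teich (teich-* x∈𝒯 (teich-* (teich-* (hat-teich _) (teich-pow (2 ^ i) y∈𝒯)) (teich-pow (2 ^ j) z∈𝒯))))) ⟩
    sumBelow r (λ i → sumBelow r (λ j → frobeniusSum (x * T i j)))    ≡⟨ sumBelow-cong r (λ i _ → sumBelow-cong r (λ j _ → sumBelow-cong r (λ k _ → Rᶠ.pow-monomial (Â i j) x y z i j k))) ⟩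
    Rᶠ.tripleSum Â x y z                                              ∎
    where
    T : ℕ → ℕ → Car R
    T i j = Â i j * pow y (2 ^ i) * pow z (2 ^ j)

  trᴿ-∘ᴿ-swap : ∀ {x y z} → IsTeich x → IsTeich y → IsTeich z → trᴿ (x * (y ∘ᴿ z)) ≡ trᴿ (y * (x ∘ᴿ z))
  trᴿ-∘ᴿ-swap x∈𝒯 y∈𝒯 z∈𝒯 = begin
    trᴿ (_ * (_ ∘ᴿ _))          ≡⟨ trᴿ-∘ᴿ-expansion x∈𝒯 y∈𝒯 z∈𝒯 ⟩
    Rᶠ.tripleSum Â _ _ _        ≡⟨ Rᶠ.tripleSum-swap Â (λ i j → cong hat (A-periodicˡ i j)) (λ i j → cong hat (A-periodicʳ i j))
                                     (λ i j → teich-pow-2^-periodic (hat-teich _)) Â-symmetry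
                                     (teich-pow-2^-periodic x∈𝒯) (teich-pow-2^-periodic y∈𝒯) (teich-pow-2^-periodic z∈𝒯) ⟩
    Rᶠ.tripleSum Â _ _ _        ≡⟨ sym (trᴿ-∘ᴿ-expansion y∈𝒯 x∈𝒯 z∈𝒯) ⟩
    trᴿ (_ * (_ ∘ᴿ _))          ∎
    where
    Â-symmetry : ∀ i j → i ℕ.< r → j ℕ.< r → pow (Â (r ∸ i) (j ℕ.+ (r ∸ i))) (2 ^ i) ≡ Â i j
    Â-symmetry i j i<r j<r = trans (sym (hat-pow _ (2 ^ i))) (cong hat (coefficient-symmetry i j i<r j<r))

  Q : Car F → Car F → Car R
  Q m w = trᴿ (hat w * (hat w ∘ᴿ hat m))

  module Polarization (m w u : Car F) where

    open TeichmüllerSum (hat-teich w) (hat-teich u) public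

    W U M Lw Lu Ls : Car R
    W = hat w
    U = hat u
    M = hat m
    Lw = W ∘ᴿ M
    Lu = U ∘ᴿ M
    Ls = carry ∘ᴿ M

    hat-+ : hat (w F.+ u) ≡ teichPart
    hat-+ = cong hat (sym (cong₂ F._+_ (π-hat w) (π-hat u)))

    teichPart-∘ᴿ : teichPart ∘ᴿ M ≡ Lw + Lu + two * Ls
    teichPart-∘ᴿ = begin
      teichPart ∘ᴿ M
        ≡⟨ ∘ᴿ-expansion teichPart M ⟩
      sumBelow r (λ i → sumBelow r (λ j → Â i j * pow teichPart (2 ^ i) * pow M (2 ^ j)))
        ≡⟨ sumBelow-cong r (λ i _ → sumBelow-cong r (λ j _ → term i j)) ⟩
      sumBelow r (λ i → sumBelow r (λ j → T W i j + T U i j + two * T carry i j))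
        ≡⟨ sumBelow-cong r (λ i _ → trans (sumBelow-+ r _ _) (cong₂ _+_ (sumBelow-+ r _ _) (sumBelow-*ˡ r two _))) ⟩
      sumBelow r (λ i → sumBelow r (T W i) + sumBelow r (T U i) + two * sumBelow r (T carry i))
        ≡⟨ trans (sumBelow-+ r _ _) (cong₂ _+_ (sumBelow-+ r _ _) (sumBelow-*ˡ r two _)) ⟩
      ΣT W + ΣT U + two * ΣT carry
        ≡⟨ sym (cong₂ _+_ (cong₂ _+_ (∘ᴿ-expansion W M) (∘ᴿ-expansion U M)) (cong (two *_) (∘ᴿ-expansion carry M))) ⟩
      Lw + Lu + two * Ls ∎
      where
      T : Car R → ℕ → ℕ → Car R
      T x i j = Â i j * pow x (2 ^ i) * pow M (2 ^ j)
      ΣT : Car R → Car R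
      ΣT x = sumBelow r (λ i → sumBelow r (T x i))
      term : ∀ i j → T teichPart i j ≡ T W i j + T U i j + two * T carry i j
      term i j = trans (cong (λ t → Â i j * t * pow M (2 ^ j)) (pow-teichPart i))
        (solve 6 (λ h p p′ t s n → h :* (p :+ p′ :+ t :* s) :* n := h :* p :* n :+ h :* p′ :* n :+ t :* (h :* s :* n)) refl _ _ _ two _ _)

    cross : Car R
    cross = carry * (Lw + Lu) + (W + U) * Ls

    product-expansion : (W + U + two * carry) * (Lw + Lu + two * Ls) ≡ W * Lw + U * Lu + (W * Lu + U * Lw) + two * cross
    product-expansion = begin
      (W + U + two * carry) * (Lw + Lu + two * Ls)
        ≡⟨ solve 7 (λ w u s a b c t → (w :+ u :+ t :* s) :* (a :+ b :+ t :* c) := w :* a :+ u :* b :+ (w :* b :+ u :* a) :+ t :* (s :* (a :+ b) :+ (w :+ u) :* c) :+ t :* (t :* (s :* c))) refl W U carry Lw Lu Ls two ⟩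
      W * Lw + U * Lu + (W * Lu + U * Lw) + two * cross + two * (two * (carry * Ls))
        ≡⟨ trans (cong (W * Lw + U * Lu + (W * Lu + U * Lw) + two * cross +_) (two*[two*x]≡0# _)) (+-identityʳ _) ⟩
      W * Lw + U * Lu + (W * Lu + U * Lw) + two * cross ∎

    -- Modulo 2 the cross term is a sum of pairs tr(σ (x ∘ m)) + tr(x (σ ∘ m)), which cancel.
    two*frobeniusSum-cross≡0# : two * frobeniusSum cross ≡ 0#
    two*frobeniusSum-cross≡0# = π≡0⇒two*≡0# _ (trans (π-frobeniusSum cross) (trans (cong tr π-cross) trace-vanishes))
      where
      σ : Car F
      σ = π carry
      π-∘ᴿ-hat : ∀ x → π (hat x ∘ᴿ M) ≡ x ∘ m
      π-∘ᴿ-hat x = trans (π-∘ᴿ (hat x) m) (cong (_∘ m) (π-hat x))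
      π-cross : π cross ≡ σ F.* (w ∘ m F.+ u ∘ m) F.+ (w F.+ u) F.* (σ ∘ m)
      π-cross = trans (π-+ _ _) (cong₂ F._+_
        (trans (π-* _ _) (cong (σ F.*_) (trans (π-+ _ _) (cong₂ F._+_ (π-∘ᴿ-hat w) (π-∘ᴿ-hat u)))))
        (trans (π-* _ _) (cong₂ F._*_ (trans (π-+ _ _) (cong₂ F._+_ (π-hat w) (π-hat u))) (π-∘ᴿ carry m))))
      pair : ∀ x → tr (σ F.* (x ∘ m)) F.+ tr (x F.* (σ ∘ m)) ≡ F.0#
      pair x = trans (cong (tr (σ F.* (x ∘ m)) F.+_) (trans (trace-symmetric x σ m) (cong tr (F.*-comm _ _)))) (F₂.x+x≡0# _)
      trace-vanishes : tr (σ F.* (w ∘ m F.+ u ∘ m) F.+ (w F.+ u) F.* (σ ∘ m)) ≡ F.0#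
      trace-vanishes = begin
        tr (σ F.* (w ∘ m F.+ u ∘ m) F.+ (w F.+ u) F.* (σ ∘ m))
          ≡⟨ cong tr (F.solve 6 (λ s a b w u c → s F.:* (a F.:+ b) F.:+ (w F.:+ u) F.:* c F.:= (s F.:* a F.:+ w F.:* c) F.:+ (s F.:* b F.:+ u F.:* c)) refl σ (w ∘ m) (u ∘ m) w u (σ ∘ m)) ⟩
        tr ((σ F.* (w ∘ m) F.+ w F.* (σ ∘ m)) F.+ (σ F.* (u ∘ m) F.+ u F.* (σ ∘ m)))
          ≡⟨ trans (F₂.trace-+ r _ _) (cong₂ F._+_ (trans (F₂.trace-+ r _ _) (pair w)) (trans (F₂.trace-+ r _ _) (pair u))) ⟩
        F.0# F.+ F.0#
          ≡⟨ F.+-identityʳ _ ⟩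
        F.0# ∎

  Q-+ : ∀ m w u → Q m (w F.+ u) ≡ Q m w + Q m u + two * frobeniusSum (hat w * (hat u ∘ᴿ hat m))
  Q-+ m w u = begin
    trᴿ (hat (w F.+ u) * (hat (w F.+ u) ∘ᴿ M))          ≡⟨ cong (λ t → trᴿ (t * (t ∘ᴿ M))) hat-+ ⟩
    trᴿ (teichPart * (teichPart ∘ᴿ M))                  ≡⟨ cong₂ (λ s t → trᴿ (s * t)) teichPart≡a+a′+two*carry teichPart-∘ᴿ ⟩
    trᴿ ((W + U + two * carry) * (Lw + Lu + two * Ls))  ≡⟨ cong trᴿ product-expansion ⟩
    trᴿ (W * Lw + U * Lu + (W * Lu + U * Lw) + two * cross)
      ≡⟨ trans (trᴿ-+ _ _) (cong₂ _+_ (trans (trᴿ-+ _ _) (cong₂ _+_ (trᴿ-+ _ _) (trᴿ-+ _ _))) (trᴿ-two* cross)) ⟩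
    trᴿ (W * Lw) + trᴿ (U * Lu) + (trᴿ (W * Lu) + trᴿ (U * Lw)) + two * frobeniusSum cross
      ≡⟨ cong₂ (λ s t → trᴿ (W * Lw) + trᴿ (U * Lu) + (trᴿ (W * Lu) + s) + t) (trᴿ-∘ᴿ-swap (hat-teich u) (hat-teich w) (hat-teich m)) two*frobeniusSum-cross≡0# ⟩
    Q m w + Q m u + (trᴿ (W * Lu) + trᴿ (W * Lu)) + 0#
      ≡⟨ trans (+-identityʳ _) (cong (Q m w + Q m u +_) (trans (x+x≡two*x _) (two*trᴿ _))) ⟩
    Q m w + Q m u + two * frobeniusSum (W * Lu) ∎
    where open Polarization m w u

module MUBConstruction
  (r₀ : ℕ) (F R : FinCommRing) (isField : IsFieldOfOrder F (2 ^ suc r₀))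
  (π : Car R → Car F) (isGaloisRing : IsGaloisRing4 (suc r₀) F R π)
  (C : CyclicGen (suc r₀) R) (hat : Car F → Car R) (isTeichLift : IsTeichLift F R π C hat)
  (Tr : Car R → Fin 4) (isTrace : IsGRTrace (suc r₀) R C Tr)
  (ω : ℤi) (ω²≡-1 : ω *ᵢ ω ≡ -1ᵢ)
  (_∘_ : Car F → Car F → Car F) (isSymplectic : IsSymplecticPresemifield (suc r₀) F _∘_)
  (a : Fin (suc r₀) → Fin (suc r₀) → Car F) (∘-linearized : ∀ x y → x ∘ y ≡ linearized F (suc r₀) a x y) where

  open SymplecticPresemifield r₀ F R isField π isGaloisRing C hat isTeichLift Tr isTrace _∘_ isSymplectic a ∘-linearized
  open FinCommRingProperties R
  open FourthRootOfUnity ω ω²≡-1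
  open ≡-Reasoning

  private
    module 𝔽 = FiniteFieldOfCharacteristicTwo F isField F-two≡0#
    open 𝔽.FrobeniusIndependence r (π (CyclicGen.g C)) generator-separating using (trace-nondegenerate)

    ω^-cong-≤ : ∀ {x y} → x ℕ.≤ y → ι y ≡ ι x → ω^ y ≡ ω^ x
    ω^-cong-≤ {x} {y} x≤y ιy≡ιx with ι≡0#⇒4∣ (y ℕ.∸ x) ι[y∸x]≡0
      where
      ι[y∸x]≡0 : ι (y ℕ.∸ x) ≡ 0#
      ι[y∸x]≡0 = +-cancelˡ (ι x) _ _ (trans (sym (ι-+ x (y ℕ.∸ x))) (trans (cong ι (ℕ.m+[n∸m]≡n x≤y)) (trans ιy≡ιx (sym (+-identityʳ _)))))
    ... | k , y∸x≡4k = begin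
      ω^ y                      ≡⟨ cong ω^_ (sym (ℕ.m+[n∸m]≡n x≤y)) ⟩
      ω^ (x ℕ.+ (y ℕ.∸ x))      ≡⟨ ω^-+ x (y ℕ.∸ x) ⟩
      ω^ x *ᵢ ω^ (y ℕ.∸ x)      ≡⟨ cong (λ t → ω^ x *ᵢ ω^ t) y∸x≡4k ⟩
      ω^ x *ᵢ ω^ (4 ℕ.* k)      ≡⟨ cong (ω^ x *ᵢ_) (ω^[4*k]≡1 k) ⟩
      ω^ x *ᵢ 1ᵢ                ≡⟨ ℤ[i].*-identityʳ _ ⟩
      ω^ x                      ∎

  ω^-cong : ∀ x y → ι x ≡ ι y → ω^ x ≡ ω^ y
  ω^-cong x y ιx≡ιy with ℕ.≤-total x y
  ... | inj₁ x≤y = sym (ω^-cong-≤ x≤y (sym ιx≡ιy))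
  ... | inj₂ y≤x = ω^-cong-≤ y≤x ιx≡ιy

  ι-+3* : ∀ x y → ι (x ℕ.+ 3 ℕ.* y) ≡ ι x + - ι y
  ι-+3* x y = trans (ι-+ x _) (cong (ι x +_) (trans (ι-* 3 y) (trans (cong (_* ι y) ι3≡-1#) (trans (sym (-‿distribˡ-* 1# _)) (cong -_ (*-identityˡ _))))))
    where
    ι3≡-1# : ι 3 ≡ - 1#
    ι3≡-1# = +-inverseʳ-unique 1# (ι 3) (IsGaloisRing4.char4 isGaloisRing)

  exponent : Car F → Car F → Car F → ℕ
  exponent m v w = toℕ (Tr (hat w * (hat w ∘ᴿ hat m) + two * hat w * hat v))

  ι-exponent : ∀ m v w → ι (exponent m v w) ≡ Q m w + two * frobeniusSum (hat w * hat v)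
  ι-exponent m v w = trans (trᴿ-+ _ _) (cong (Q m w +_) (trans (cong trᴿ (*-assoc two (hat w) (hat v))) (trᴿ-two* _)))

  ι-exponent-+ : ∀ m v u z → ι (exponent m v (u F.+ z)) ≡ ι (exponent m v u) + ι (exponent m v z) + two * frobeniusSum (hat u * (hat z ∘ᴿ hat m))
  ι-exponent-+ m v u z = begin
    ι (exponent m v (u F.+ z))                                   ≡⟨ ι-exponent m v (u F.+ z) ⟩
    Q m (u F.+ z) + two * S (hat (u F.+ z) * hat v)              ≡⟨ cong₂ _+_ (Q-+ m u z) (trans (two*frobeniusSum-π _ (hat u * hat v + hat z * hat v) π-distrib) (two*frobeniusSum-+ _ _)) ⟩
    Q m u + Q m z + P + (two * S (hat u * hat v) + two * S (hat z * hat v))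
                                                                 ≡⟨ solve 5 (λ a b p c d → a :+ b :+ p :+ (c :+ d) := a :+ c :+ (b :+ d) :+ p) refl _ _ _ _ _ ⟩
    Q m u + two * S (hat u * hat v) + (Q m z + two * S (hat z * hat v)) + P
                                                                 ≡⟨ sym (cong₂ (λ s t → s + t + P) (ι-exponent m v u) (ι-exponent m v z)) ⟩
    ι (exponent m v u) + ι (exponent m v z) + P                  ∎
    where
    S : Car R → Car R
    S = frobeniusSum
    P : Car R
    P = two * S (hat u * (hat z ∘ᴿ hat m))
    π-hat-* : ∀ x y → π (hat x * hat y) ≡ x F.* y
    π-hat-* x y = trans (π-* _ _) (cong₂ F._*_ (π-hat x) (π-hat y))
    π-distrib : π (hat (u F.+ z) * hat v) ≡ π (hat u * hat v + hat z * hat v)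
    π-distrib = trans (π-hat-* _ v) (sym (trans (π-+ _ _) (trans (cong₂ F._+_ (π-hat-* u v) (π-hat-* z v)) (sym (F.distribʳ v u z)))))

  π-frobeniusSum-∘ᴿ : ∀ u z m → π (frobeniusSum (hat u * (hat z ∘ᴿ hat m))) ≡ tr (u F.* (z ∘ m))
  π-frobeniusSum-∘ᴿ u z m = trans (π-frobeniusSum _) (cong tr (trans (π-* _ _) (cong₂ F._*_ (π-hat u) (trans (π-∘ᴿ (hat z) m) (cong (_∘ m) (π-hat z))))))

  -- Character sums

  private
    Σᵢ : (Car F → ℤi) → ℤi
    Σᵢ = ℤ[i].sumOver F.elems

    Σᵢ-translate : ∀ c (f : Car F → ℤi) → Σᵢ (λ w → f (w F.+ c)) ≡ Σᵢ f
    Σᵢ-translate c = ℤ[i].sumOver-bijection F._≟_ F.elems F.elems-unique F.elems-complete (F._+ c) (F._+ F.- c)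
      (λ w → F.solve 2 (λ w c → w F.:+ F.:- c F.:+ c F.:= w) refl w c) (λ w → F.solve 2 (λ w c → w F.:+ c F.:+ F.:- c F.:= w) refl w c)

  -- If the exponent is B + 2 Y(w) with Y(w) ≡ tr(w c) mod 2, c ≠ 0, then translating w by u₀ with
  -- tr(u₀ c) = 1 multiplies every term by ω² = -1.
  character-sum-vanishes : (k : Car F → ℕ) (B : Car R) (Y : Car F → Car R) (c : Car F) → ¬ (c ≡ F.0#) →
    (∀ w → ι (k w) ≡ B + two * Y w) → (∀ w → π (Y w) ≡ tr (w F.* c)) → Σᵢ (λ w → ω^ (k w)) ≡ 0ᵢ
  character-sum-vanishes k B Y c c≢0 ι-k π-Y = ≡negᵢ⇒≡0ᵢ (Σᵢ (λ w → ω^ (k w))) (begin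
    Σᵢ (λ w → ω^ (k w))                ≡⟨ sym (Σᵢ-translate u₀ (λ w → ω^ (k w))) ⟩
    Σᵢ (λ w → ω^ (k (w F.+ u₀)))       ≡⟨ ℤ[i].sumOver-cong F.elems translated-term ⟩
    Σᵢ (λ w → negᵢ (ω^ (k w)))         ≡⟨ ℤ[i].sumOver-neg F.elems _ ⟩
    negᵢ (Σᵢ (λ w → ω^ (k w)))         ∎)
    where
    u₀ : Car F
    u₀ = proj₁ (trace-nondegenerate (ℕ.s≤s ℕ.z≤n) F-pow-q c c≢0)
    tr[u₀c]≡1 : tr (u₀ F.* c) ≡ F.1#
    tr[u₀c]≡1 = proj₂ (trace-nondegenerate (ℕ.s≤s ℕ.z≤n) F-pow-q c c≢0)
    translated-term : ∀ w → ω^ (k (w F.+ u₀)) ≡ negᵢ (ω^ (k w))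
    translated-term w = begin
      ω^ (k (w F.+ u₀))          ≡⟨ ω^-cong _ _ ι-shift ⟩
      ω^ (k w ℕ.+ 2)             ≡⟨ ω^-+ (k w) 2 ⟩
      ω^ (k w) *ᵢ ω^ 2           ≡⟨ cong (ω^ (k w) *ᵢ_) ω^2≡-1 ⟩
      ω^ (k w) *ᵢ -1ᵢ            ≡⟨ ℤ[i].solve 1 (λ x → x ℤ[i].:* ℤ[i].:- ℤ[i].con (ℤ.+ 1) ℤ[i].:= ℤ[i].:- x) refl (ω^ (k w)) ⟩
      negᵢ (ω^ (k w))            ∎
      where
      π-Y-shift : π (Y (w F.+ u₀)) ≡ π (Y w + 1#)
      π-Y-shift = trans (π-Y _) (trans (cong tr (F.distribʳ c w u₀)) (trans (F₂.trace-+ r _ _)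
                    (sym (trans (π-+ _ _) (cong₂ F._+_ (π-Y w) (trans π-1 (sym tr[u₀c]≡1)))))))
      ι-shift : ι (k (w F.+ u₀)) ≡ ι (k w ℕ.+ 2)
      ι-shift = begin
        ι (k (w F.+ u₀))           ≡⟨ ι-k _ ⟩
        B + two * Y (w F.+ u₀)     ≡⟨ cong (B +_) (π≡⇒two*≡ _ _ π-Y-shift) ⟩
        B + two * (Y w + 1#)       ≡⟨ cong (B +_) (trans (distribˡ two _ _) (cong (two * Y w +_) (*-identityʳ two))) ⟩
        B + (two * Y w + two)      ≡⟨ sym (+-assoc _ _ _) ⟩
        B + two * Y w + two        ≡⟨ cong₂ _+_ (sym (ι-k w)) (cong (1# +_) (sym (+-identityʳ 1#))) ⟩
        ι (k w) + ι 2              ≡⟨ sym (ι-+ (k w) 2) ⟩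
        ι (k w ℕ.+ 2)              ∎

  Σᵢ-unit : (k : Car F → ℕ) → Σᵢ (λ w → ω^ (k w) *ᵢ conjᵢ (ω^ (k w))) ≡ fromℕᵢ q
  Σᵢ-unit k = begin
    Σᵢ (λ w → ω^ (k w) *ᵢ conjᵢ (ω^ (k w)))   ≡⟨ ℤ[i].sumOver-cong F.elems (λ w → ω^-unit (k w)) ⟩
    Σᵢ (λ _ → 1ᵢ)                              ≡⟨ ℤ[i].sumOver-const F.elems 1ᵢ ⟩
    length F.elems ℤ[i].× 1ᵢ                   ≡⟨ ×1ᵢ≡fromℕᵢ _ ⟩
    fromℕᵢ (length F.elems)                    ≡⟨ cong fromℕᵢ (IsFieldOfOrder.card isField) ⟩
    fromℕᵢ q                                   ∎
    where
    ×1ᵢ≡fromℕᵢ : ∀ n → n ℤ[i].× 1ᵢ ≡ fromℕᵢ n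
    ×1ᵢ≡fromℕᵢ zero = refl
    ×1ᵢ≡fromℕᵢ (suc n) = cong (1ᵢ +ᵢ_) (×1ᵢ≡fromℕᵢ n)

  ω^-*-conjᵢ : ∀ x y → ω^ x *ᵢ conjᵢ (ω^ y) ≡ ω^ (x ℕ.+ 3 ℕ.* y)
  ω^-*-conjᵢ x y = trans (cong (ω^ x *ᵢ_) (conjᵢ-ω^ y)) (sym (ω^-+ x (3 ℕ.* y)))

  -- Distinct bases B_m, B_m′: the cross term of |G|² at shift z ≠ 0 is a character sum
  -- for the nonzero element z ∘ (m + m′).
  module GaussSum (m v m′ v′ : Car F) (m≢m′ : ¬ (m ≡ m′)) where

    d : Car F → ℕ
    d w = exponent m v w ℕ.+ 3 ℕ.* exponent m′ v′ w

    G : ℤi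
    G = Σᵢ (λ w → ω^ (d w))

    private
      P : Car F → Car F → Car F → Car R
      P m z u = frobeniusSum (hat u * (hat z ∘ᴿ hat m))

    ι-d-shift : ∀ z u → ι (d (u F.+ z) ℕ.+ 3 ℕ.* d u) ≡ ι (d z) + two * (P m z u + P m′ z u)
    ι-d-shift z u = begin
      ι (d (u F.+ z) ℕ.+ 3 ℕ.* d u)                               ≡⟨ ι-+3* (d (u F.+ z)) (d u) ⟩
      ι (d (u F.+ z)) + - ι (d u)                                 ≡⟨ cong₂ (λ s s′ → s + - s′) (ι-+3* (exponent m v (u F.+ z)) (exponent m′ v′ (u F.+ z))) (ι-+3* (exponent m v u) (exponent m′ v′ u)) ⟩
      ι (exponent m v (u F.+ z)) + - ι (exponent m′ v′ (u F.+ z)) + - (Eu + - E′u)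
                                                                  ≡⟨ cong₂ (λ s s′ → s + - s′ + - (Eu + - E′u)) (ι-exponent-+ m v u z) (ι-exponent-+ m′ v′ u z) ⟩
      (Eu + Ez + two * P m z u) + - (E′u + E′z + two * P m′ z u) + - (Eu + - E′u)
                                                                  ≡⟨ solve 6 (λ a b p c e p′ → (a :+ b :+ p) :+ :- (c :+ e :+ p′) :+ :- (a :+ :- c) := b :+ :- e :+ (p :+ :- p′)) refl Eu Ez (two * P m z u) E′u E′z (two * P m′ z u) ⟩
      Ez + - E′z + (two * P m z u + - (two * P m′ z u))           ≡⟨ cong (λ s → Ez + - E′z + (two * P m z u + s)) (-[two*x]≡two*x _) ⟩
      Ez + - E′z + (two * P m z u + two * P m′ z u)               ≡⟨ cong₂ _+_ (sym (ι-+3* (exponent m v z) (exponent m′ v′ z))) (sym (distribˡ two _ _)) ⟩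
      ι (d z) + two * (P m z u + P m′ z u)                        ∎
      where
      Eu Ez E′u E′z : Car R
      Eu = ι (exponent m v u)
      Ez = ι (exponent m v z)
      E′u = ι (exponent m′ v′ u)
      E′z = ι (exponent m′ v′ z)

    shifted-sum-vanishes : ∀ z → ¬ (z ≡ F.0#) → Σᵢ (λ u → ω^ (d (u F.+ z)) *ᵢ conjᵢ (ω^ (d u))) ≡ 0ᵢ
    shifted-sum-vanishes z z≢0 = trans (ℤ[i].sumOver-cong F.elems (λ u → ω^-*-conjᵢ (d (u F.+ z)) (d u)))
      (character-sum-vanishes (λ u → d (u F.+ z) ℕ.+ 3 ℕ.* d u) (ι (d z)) (λ u → P m z u + P m′ z u) (z ∘ (m F.+ m′))
        z∘[m+m′]≢0 (ι-d-shift z) π-P)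
      where
      z∘[m+m′]≢0 : ¬ (z ∘ (m F.+ m′) ≡ F.0#)
      z∘[m+m′]≢0 z∘[m+m′]≡0 with IsSymplecticPresemifield.no-zero-divisors isSymplectic z (m F.+ m′) z∘[m+m′]≡0
      ... | inj₁ z≡0 = z≢0 z≡0
      ... | inj₂ m+m′≡0 = m≢m′ (F.x∙y⁻¹≈ε⇒x≈y m m′ (trans (cong (m F.+_) (F₂.-x≡x m′)) m+m′≡0))
      π-P : ∀ u → π (P m z u + P m′ z u) ≡ tr (u F.* (z ∘ (m F.+ m′)))
      π-P u = trans (π-+ _ _) (trans (cong₂ F._+_ (π-frobeniusSum-∘ᴿ u z m) (π-frobeniusSum-∘ᴿ u z m′))
                (trans (sym (F₂.trace-+ r _ _)) (cong tr (trans (sym (F.distribˡ u _ _))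
                  (cong (u F.*_) (sym (IsSymplecticPresemifield.distribˡ isSymplectic z m m′)))))))

    G*conjᵢG≡q : G *ᵢ conjᵢ G ≡ fromℕᵢ q
    G*conjᵢG≡q = begin
      G *ᵢ conjᵢ G                                               ≡⟨ cong (G *ᵢ_) (conjᵢ-sumOver F.elems _) ⟩
      G *ᵢ Σᵢ (λ u → conjᵢ (ω^ (d u)))                           ≡⟨ sym (ℤ[i].sumOver-*ˡ F.elems G _) ⟩
      Σᵢ (λ u → G *ᵢ conjᵢ (ω^ (d u)))                           ≡⟨ ℤ[i].sumOver-cong F.elems (λ u → sym (ℤ[i].sumOver-*ʳ F.elems _ _)) ⟩
      Σᵢ (λ u → Σᵢ (λ w → ω^ (d w) *ᵢ conjᵢ (ω^ (d u))))         ≡⟨ ℤ[i].sumOver-cong F.elems (λ u → sym (Σᵢ-reindex u)) ⟩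
      Σᵢ (λ u → Σᵢ (λ z → ω^ (d (u F.+ z)) *ᵢ conjᵢ (ω^ (d u)))) ≡⟨ ℤ[i].sumOver-swap F.elems F.elems _ ⟩
      Σᵢ (λ z → Σᵢ (λ u → ω^ (d (u F.+ z)) *ᵢ conjᵢ (ω^ (d u)))) ≡⟨ ℤ[i].sumOver-single F.elems _ F.0# F.elems-unique (F.elems-complete _) shifted-sum-vanishes ⟩
      Σᵢ (λ u → ω^ (d (u F.+ F.0#)) *ᵢ conjᵢ (ω^ (d u)))         ≡⟨ ℤ[i].sumOver-cong F.elems (λ u → cong (λ s → ω^ (d s) *ᵢ conjᵢ (ω^ (d u))) (F.+-identityʳ u)) ⟩
      Σᵢ (λ u → ω^ (d u) *ᵢ conjᵢ (ω^ (d u)))                    ≡⟨ Σᵢ-unit d ⟩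
      fromℕᵢ q                                                   ∎
      where
      Σᵢ-reindex : ∀ u → Σᵢ (λ z → ω^ (d (u F.+ z)) *ᵢ conjᵢ (ω^ (d u))) ≡ Σᵢ (λ w → ω^ (d w) *ᵢ conjᵢ (ω^ (d u)))
      Σᵢ-reindex u = trans (ℤ[i].sumOver-cong F.elems (λ z → cong (λ s → ω^ (d s) *ᵢ conjᵢ (ω^ (d u))) (F.+-comm u z)))
                           (Σᵢ-translate u (λ w → ω^ (d w) *ᵢ conjᵢ (ω^ (d u))))

    normSq-G : normSq G ≡ ℤ.+ q
    normSq-G = cong ℤi.re (trans (sym (*ᵢ-conjᵢ G)) G*conjᵢG≡q)

  vec : Maybe (Car F) → Car F → Car F → ℤi
  vec = mubVec r F R hat Tr ω a

  scaleSq : Maybe (Car F) → ℕ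
  scaleSq = mubScaleSq r F R hat Tr ω a

  private
    Σᵢ-single : ∀ (f : Car F → ℤi) v → (∀ w → ¬ (w ≡ v) → f w ≡ 0ᵢ) → Σᵢ f ≡ f v
    Σᵢ-single f v = ℤ[i].sumOver-single F.elems f v F.elems-unique (F.elems-complete v)

    e-off : ∀ v w → ¬ (w ≡ v) → vec nothing v w ≡ 0ᵢ
    e-off v w w≢v with w F.≟ v
    ... | yes w≡v = ⊥-elim (w≢v w≡v)
    ... | no _ = refl

    e-on : ∀ v → vec nothing v v ≡ 1ᵢ
    e-on v with v F.≟ v
    ... | yes _ = refl
    ... | no v≢v = ⊥-elim (v≢v refl)

    inner-e : ∀ v (Y : Car F → ℤi) → innerᵢ F (vec nothing v) Y ≡ conjᵢ (Y v)
    inner-e v Y = trans (Σᵢ-single (λ w → vec nothing v w *ᵢ conjᵢ (Y w)) v (λ w w≢v → trans (cong (_*ᵢ conjᵢ (Y w)) (e-off v w w≢v)) (ℤ[i].zeroˡ (conjᵢ (Y w)))))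
                        (trans (cong (_*ᵢ conjᵢ (Y v)) (e-on v)) (ℤ[i].*-identityˡ (conjᵢ (Y v))))

    inner-just : ∀ m v m′ v′ → innerᵢ F (vec (just m) v) (vec (just m′) v′) ≡ Σᵢ (λ w → ω^ (exponent m v w ℕ.+ 3 ℕ.* exponent m′ v′ w))
    inner-just m v m′ v′ = ℤ[i].sumOver-cong F.elems (λ w → ω^-*-conjᵢ (exponent m v w) (exponent m′ v′ w))

  orthogonal : ∀ s v v′ → ¬ (v ≡ v′) → innerᵢ F (vec s v) (vec s v′) ≡ 0ᵢ
  orthogonal nothing v v′ v≢v′ = trans (inner-e v (vec nothing v′)) (cong conjᵢ (e-off v′ v v≢v′))
  orthogonal (just m) v v′ v≢v′ = trans (inner-just m v m v′)
    (character-sum-vanishes (λ w → exponent m v w ℕ.+ 3 ℕ.* exponent m v′ w) 0# (λ w → frobeniusSum (hat w * hat v) + frobeniusSum (hat w * hat v′)) (v F.+ v′) v+v′≢0 ι-d π-Y)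
    where
    v+v′≢0 : ¬ (v F.+ v′ ≡ F.0#)
    v+v′≢0 v+v′≡0 = v≢v′ (F.x∙y⁻¹≈ε⇒x≈y v v′ (trans (cong (v F.+_) (F₂.-x≡x v′)) v+v′≡0))
    ι-d : ∀ w → ι (exponent m v w ℕ.+ 3 ℕ.* exponent m v′ w) ≡ 0# + two * (frobeniusSum (hat w * hat v) + frobeniusSum (hat w * hat v′))
    ι-d w = begin
      ι (exponent m v w ℕ.+ 3 ℕ.* exponent m v′ w)          ≡⟨ ι-+3* (exponent m v w) (exponent m v′ w) ⟩
      ι (exponent m v w) + - ι (exponent m v′ w)            ≡⟨ cong₂ (λ s s′ → s + - s′) (ι-exponent m v w) (ι-exponent m v′ w) ⟩
      (Q m w + two * S v) + - (Q m w + two * S v′)          ≡⟨ solve 3 (λ q a b → (q :+ a) :+ :- (q :+ b) := con (ℤ.+ 0) :+ (a :+ :- b)) refl (Q m w) (two * S v) (two * S v′) ⟩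
      0# + (two * S v + - (two * S v′))                     ≡⟨ cong (λ s → 0# + (two * S v + s)) (-[two*x]≡two*x _) ⟩
      0# + (two * S v + two * S v′)                         ≡⟨ cong (0# +_) (sym (distribˡ two _ _)) ⟩
      0# + two * (S v + S v′)                               ∎
      where
      S : Car F → Car R
      S x = frobeniusSum (hat w * hat x)
    π-Y : ∀ w → π (frobeniusSum (hat w * hat v) + frobeniusSum (hat w * hat v′)) ≡ tr (w F.* (v F.+ v′))
    π-Y w = trans (π-+ _ _) (trans (cong₂ F._+_ (π-S v) (π-S v′)) (trans (sym (F₂.trace-+ r _ _)) (cong tr (sym (F.distribˡ w v v′)))))
      where π-S : ∀ x → π (frobeniusSum (hat w * hat x)) ≡ tr (w F.* x)
            π-S x = trans (π-frobeniusSum _) (cong tr (trans (π-* _ _) (cong₂ F._*_ (π-hat w) (π-hat x))))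

  normalized : ∀ s v → innerᵢ F (vec s v) (vec s v) ≡ fromℕᵢ (scaleSq s)
  normalized nothing v = trans (inner-e v (vec nothing v)) (cong conjᵢ (e-on v))
  normalized (just m) v = Σᵢ-unit (exponent m v)

  unbiased : ∀ s s′ → ¬ (s ≡ s′) → ∀ v v′ → ℤ.+ q ℤ.* normSq (innerᵢ F (vec s v) (vec s′ v′)) ≡ ℤ.+ (scaleSq s ℕ.* scaleSq s′)
  unbiased nothing nothing s≢s′ = ⊥-elim (s≢s′ refl)
  unbiased nothing (just m′) _ v v′ = begin
    ℤ.+ q ℤ.* normSq (innerᵢ F (vec nothing v) (vec (just m′) v′))  ≡⟨ cong (λ z → ℤ.+ q ℤ.* normSq z) (trans (inner-e v (vec (just m′) v′)) (conjᵢ-ω^ (exponent m′ v′ v))) ⟩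
    ℤ.+ q ℤ.* normSq (ω^ (3 ℕ.* exponent m′ v′ v))                 ≡⟨ cong (ℤ.+ q ℤ.*_) (normSq-ω^ (3 ℕ.* exponent m′ v′ v)) ⟩
    ℤ.+ q ℤ.* ℤ.+ 1                                                ≡⟨ ℤP.*-identityʳ _ ⟩
    ℤ.+ q                                                          ≡⟨ cong ℤ.+_ (sym (ℕ.*-identityˡ q)) ⟩
    ℤ.+ (1 ℕ.* q)                                                  ∎
  unbiased (just m) nothing _ v v′ = begin
    ℤ.+ q ℤ.* normSq (innerᵢ F (vec (just m) v) (vec nothing v′))  ≡⟨ cong (λ z → ℤ.+ q ℤ.* normSq z) single-term ⟩
    ℤ.+ q ℤ.* normSq (ω^ (exponent m v v′))                        ≡⟨ cong (ℤ.+ q ℤ.*_) (normSq-ω^ (exponent m v v′)) ⟩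
    ℤ.+ q ℤ.* ℤ.+ 1                                                ≡⟨ ℤP.*-identityʳ _ ⟩
    ℤ.+ q                                                          ≡⟨ cong ℤ.+_ (sym (ℕ.*-identityʳ q)) ⟩
    ℤ.+ (q ℕ.* 1)                                                  ∎
    where
    single-term : innerᵢ F (vec (just m) v) (vec nothing v′) ≡ ω^ (exponent m v v′)
    single-term = trans (Σᵢ-single (λ w → ω^ (exponent m v w) *ᵢ conjᵢ (vec nothing v′ w)) v′ (λ w w≢v′ → trans (cong (λ s → ω^ (exponent m v w) *ᵢ conjᵢ s) (e-off v′ w w≢v′)) (ℤ[i].zeroʳ (ω^ (exponent m v w)))))
                        (trans (cong (λ s → ω^ (exponent m v v′) *ᵢ conjᵢ s) (e-on v′)) (ℤ[i].*-identityʳ (ω^ (exponent m v v′))))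
  unbiased (just m) (just m′) s≢s′ v v′ = begin
    ℤ.+ q ℤ.* normSq (innerᵢ F (vec (just m) v) (vec (just m′) v′))  ≡⟨ cong (λ z → ℤ.+ q ℤ.* normSq z) (inner-just m v m′ v′) ⟩
    ℤ.+ q ℤ.* normSq (GaussSum.G m v m′ v′ m≢m′)                     ≡⟨ cong (ℤ.+ q ℤ.*_) (GaussSum.normSq-G m v m′ v′ m≢m′) ⟩
    ℤ.+ q ℤ.* ℤ.+ q                                                  ≡⟨ ℤP.+◃n≡+n (q ℕ.* q) ⟩
    ℤ.+ (q ℕ.* q)                                                    ∎
    where
    m≢m′ : ¬ (m ≡ m′)
    m≢m′ m≡m′ = s≢s′ (cong just m≡m′)

  isCompleteMUB : IsCompleteMUB F q vec scaleSq
  isCompleteMUB = record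
    { dimension = IsFieldOfOrder.card isField ; orthogonal = orthogonal ; normalized = normalized ; unbiased = unbiased }

¬IsFieldOfOrder-1 : ∀ K → ¬ IsFieldOfOrder K 1
¬IsFieldOfOrder-1 K isField = IsFieldOfOrder.0≢1 isField
  (singleton (FinCommRing.elems K) (IsFieldOfOrder.card isField) (FinCommRing.elems-complete K _) (FinCommRing.elems-complete K _))
  where
  singleton : {A : Set} (xs : List A) {x y : A} → length xs ≡ 1 → x ∈ xs → y ∈ xs → x ≡ y
  singleton (_ ∷ []) _ (here x≡z) (here y≡z) = trans x≡z (sym y≡z)

theorem4p2 : (r : ℕ) (F R : FinCommRing) →
    IsFieldOfOrder F (2 ^ r) →
    (π : Car R → Car F) → IsGaloisRing4 r F R π →
    (C : CyclicGen r R) →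
    (hat : Car F → Car R) → IsTeichLift F R π C hat →
    (Tr : Car R → Fin 4) → IsGRTrace r R C Tr →
    (ω : ℤi) → ω *ᵢ ω ≡ -1ᵢ →
    (_∘_ : Car F → Car F → Car F) → IsSymplecticPresemifield r F _∘_ →
    (a : Fin r → Fin r → Car F) → (∀ x y → x ∘ y ≡ linearized F r a x y) →
    IsCompleteMUB F (2 ^ r) (mubVec r F R hat Tr ω a) (mubScaleSq r F R hat Tr ω a)
theorem4p2 zero F _ isField _ _ _ _ _ _ _ _ _ _ _ _ _ = ⊥-elim (¬IsFieldOfOrder-1 F isField)
theorem4p2 (suc r₀) F R isField π isGaloisRing C hat isTeichLift Tr isTrace ω ω²≡-1 _∘_ isSymplectic a ∘-linearized =
  MUBConstruction.isCompleteMUB r₀ F R isField π isGaloisRing C hat isTeichLift Tr isTrace ω ω²≡-1 _∘_ isSymplectic a ∘-linearized
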